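{- Let $k \ge 3$, let $0 \le v < \lvert I_{k-2}\rvert$, and let $0 \le u \le 2^{k-1}-b_k$ be integers. Then $$M(a_k+v)=M(2^{k-2}-(a_{k-2}+v))+M(a_{k-2}+v),$$ $$M(b_k+u)=M(2^{k-1}-(a_{k-1}+u)),$$ $$M(2^k-(b_k+u))=M(2^{k-1}-(a_{k-1}+u)),$$ $$M(c_k+v)=M(a_{k-2}+v).$$
   Context: A BSD representation of an integer $n$ is a digit string $(b_{m-1}\cdots b_0)$ with $b_j\in\{1,0,-1\}$ and $n=\sum b_j2^j$; its Hamming weight is the number of nonzero digits. A non-adjacent form (NAF) is a BSD representation in which no two adjacent digits are both nonzero; it is reduced if its leading digit is nonzero. Every positive integer has exactly one reduced NAF; its length is the NAF-bitlength of $n$. $I_k$ denotes the set of positive integers of NAF-bitlength $k$; it is a set of consecutive integers (e.g. $I_1=\{1\}$, $I_2=\{2\}$, $I_3=\{3,4,5\}$), and for $k\ge3$, $\lvert I_k\rvert=2\lvert I_{k-2}\rvert+\lvert I_{k-1}\rvert$. For $n\in I_k$, a BSD representation of $n$ of length $k$ is optimal if it has the same Hamming weight as the reduced NAF of $n$; $M(n)$ denotes the number of optimal representations of $n$. Write $a_k=\min I_k$ for $k\ge1$ and $a_0=0$ (equivalently $a_1=1,a_2=2$, $a_k=2^{k-2}+a_{k-2}$). For $k\ge3$, $I_k$ is partitioned into consecutive subintervals $\mathcal{A}_k$ (first $\lvert I_{k-2}\rvert$ elements), $\mathcal{B}_k$ (next $\lvert I_{k-1}\rvert$ elements), $\mathcal{C}_k$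 (last $\lvert I_{k-2}\rvert$ elements), with minima $a_k$, $b_k=a_k+\lvert I_{k-2}\rvert$, $c_k=b_k+\lvert I_{k-1}\rvert=2^{k-1}+a_{k-2}$. -}

module Defs where

open import Data.Nat using (ℕ; zero; suc; _+_; _*_; _∸_; _^_)
import Data.Nat as N
open import Data.Integer using (ℤ; +_; -[1+_]) renaming (_+_ to _+ℤ_; _*_ to _*ℤ_)
import Data.Integer as Z
open import Data.Bool using (Bool; true; false; _∧_; not)
open import Data.List using (List; []; _∷_; map; concatMap; upTo; filterᵇ)
open import Data.Nat.ListAction using (sum)
open import Data.Vec using (Vec; []; _∷_)
open import Relation.Nullary.Decidable using (⌊_⌋)

data Digit : Set where
  pos zer neg : Digit

digitVal : Digit → ℤ
digitVal pos = + 1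
digitVal zer = + 0
digitVal neg = -[1+ 0 ]

nonzero : Digit → Bool
nonzero zer = false
nonzero _   = true

-- A BSD string of length m, stored least significant digit first:
-- (b₀ ∷ b₁ ∷ … ∷ b_{m-1} ∷ []) represents Σ b_j 2^j.
value : ∀ {m} → Vec Digit m → ℤ
value []       = + 0
value (d ∷ ds) = digitVal d +ℤ (+ 2) *ℤ value ds

weight : ∀ {m} → Vec Digit m → ℕ
weight []       = 0
weight (d ∷ ds) = (if nonzero d then 1 else 0) + weight ds
  where open import Data.Bool using (if_then_else_)

isNAF : ∀ {m} → Vec Digit m → Bool
isNAF []             = true
isNAF (d ∷ [])       = true
isNAF (d ∷ e ∷ ds)   = not (nonzero d ∧ nonzero e) ∧ isNAF (e ∷ ds)

-- Leading (most significant, i.e. last stored) digit is nonzero;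
-- the empty string has no leading digit and is not reduced.
leadingNonzero : ∀ {m} → Vec Digit m → Bool
leadingNonzero []           = false
leadingNonzero (d ∷ [])     = nonzero d
leadingNonzero (d ∷ e ∷ ds) = leadingNonzero (e ∷ ds)

allBSD : (m : ℕ) → List (Vec Digit m)
allBSD zero    = [] ∷ []
allBSD (suc m) = concatMap (λ ds → (pos ∷ ds) ∷ (zer ∷ ds) ∷ (neg ∷ ds) ∷ []) (allBSD m)

count : {A : Set} → (A → Bool) → List A → ℕ
count p []       = 0
count p (x ∷ xs) = (if p x then 1 else 0) + count p xs
  where open import Data.Bool using (if_then_else_)

represents : ∀ {m} → ℕ → Vec Digit m → Bool
represents n ds = ⌊ value ds Z.≟ + n ⌋

-- Reduced NAFs of length m representing n (a list with at most one element).
reducedNAFs : (m n : ℕ) → List (Vec Digit m)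
reducedNAFs m n = filterᵇ (λ ds → isNAF ds ∧ leadingNonzero ds ∧ represents n ds) (allBSD m)

repsOfWeight : (m n w : ℕ) → ℕ
repsOfWeight m n w = count (λ ds → represents n ds ∧ ⌊ weight ds N.≟ w ⌋) (allBSD m)

-- M(n): number of optimal representations of n, i.e. BSD representations
-- of length k = NAF-bitlength(n) with the same Hamming weight as the reduced
-- NAF of n.  Since n ≥ 1 has exactly one reduced NAF and its length is at
-- most n + 1, summing over all lengths m < n + 2 and all reduced NAFs z of
-- length m picks out exactly that unique (k, z).
M : ℕ → ℕ
M n = sum (map (λ m → sum (map (λ z → repsOfWeight m n (weight z)) (reducedNAFs m n)))
               (upTo (n + 2)))

-- a_0 = 0, a_1 = 1, a_2 = 2, a_k = 2^{k-2} + a_{k-2}  (a_k = min I_k for k ≥ 1).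
a : ℕ → ℕ
a zero                = 0
a (suc zero)          = 1
a (suc (suc zero))    = 2
a (suc (suc (suc k))) = 2 ^ (suc k) + a (suc k)

-- |I_k| = a_{k+1} - a_k  (I_k is the interval [a_k, a_{k+1})), for k ≥ 1.
sizeI : ℕ → ℕ
sizeI k = a (suc k) ∸ a k

-- b_k = a_k + |I_{k-2}|,  c_k = b_k + |I_{k-1}| = 2^{k-1} + a_{k-2}.
b : ℕ → ℕ
b k = a k + sizeI (k ∸ 2)

c : ℕ → ℕ
c k = b k + sizeI (k ∸ 1)

{-# OPTIONS --safe #-}
module Submission where

-- Representations of x of length m with top digit d ∈ {1, 0, −1} are the representations of
-- x − d·2^(m−1) of length m − 1, with weight lowered by |d|.  Such a branch is empty when its
-- target is at least 2^(m−1), since strings of length m − 1 have smaller values, or when its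
-- target has a NAF heavier than the remaining weight, since a NAF has the least weight among
-- all representations of its value (shown digit by digit, carrying c ∈ {−1, 0, 1}).  On 𝒜_k,
-- n = 2^(k−2) + m with m ∈ I_(k−2), and the reduced NAF of n is that of m with its leading 1
-- replaced by −1 0 1; two branches survive: top digit 1 gives, after negation, the count for
-- 2^(k−2) − m, and top digits 0 1 give the count for m.  On 𝒞_k, ℬ_k and 2^k − ℬ_k a single
-- branch survives, and it is also what remains of the count on the right-hand side.

open import Defs
open import Data.Bool using (Bool; true; false; T; not; _∧_; if_then_else_)
open import Data.Bool.Properties using (T-∧; ∧-comm; ∧-zeroʳ)
open import Data.Empty using (⊥; ⊥-elim)
open import Data.Integer as ℤ using (ℤ; +_; -[1+_]; +[1+_]; -_)
import Data.Integer.Properties as ℤP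
import Data.Integer.Tactic.RingSolver as ℤ-Solver
open import Data.List using (List; []; _∷_; map; concatMap; filterᵇ; applyUpTo)
open import Data.Nat using (ℕ; zero; suc; _+_; _*_; _∸_; _^_; _≤_; _<_; z≤n; s≤s)
open import Data.Nat.ListAction using (sum)
open import Data.Nat.Properties
import Data.Nat.Tactic.RingSolver as ℕ-Solver
open import Data.Product using (Σ-syntax; ∃-syntax; _×_; _,_; proj₁; proj₂)
open import Data.Vec using (Vec; []; _∷_; _∷ʳ_)
import Data.Vec as Vec
open import Data.Vec.Properties using (map-∷ʳ)
open import Function using (id; _∘_; _⇔_; mk⇔; module Equivalence)
open import Relation.Binary.PropositionalEquality
open import Relation.Nullary using (¬_; Dec; does; yes; no; _×-dec_)
open import Relation.Nullary.Decidable using (⌊_⌋; isYes≗does; does-⇔; dec-false; toWitness; fromWitness)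

private variable
  m n : ℕ

boolToℕ : Bool → ℕ
boolToℕ b = if b then 1 else 0

digitWeight : Digit → ℕ
digitWeight d = boolToℕ (nonzero d)

negateDigit : Digit → Digit
negateDigit pos = neg
negateDigit zer = zer
negateDigit neg = pos

negate : Vec Digit m → Vec Digit m
negate = Vec.map negateDigit

Σ-Digit : (Digit → ℕ) → ℕ
Σ-Digit s = s pos + s zer + s neg

Σ-Digit-cong : {s t : Digit → ℕ} → (∀ d → s d ≡ t d) → Σ-Digit s ≡ Σ-Digit t
Σ-Digit-cong s≗t = cong₂ _+_ (cong₂ _+_ (s≗t pos) (s≗t zer)) (s≗t neg)

Σ-Digit-comm : (g : Digit → Digit → ℕ) →
  Σ-Digit (λ d → Σ-Digit (g d)) ≡ Σ-Digit (λ e → Σ-Digit (λ d → g d e))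
Σ-Digit-comm g = transpose (g pos pos) (g pos zer) (g pos neg) (g zer pos) (g zer zer) (g zer neg)
                            (g neg pos) (g neg zer) (g neg neg)
  where
  transpose : ∀ a b c d e f g h i →
    a + b + c + (d + e + f) + (g + h + i) ≡ a + d + g + (b + e + h) + (c + f + i)
  transpose = ℕ-Solver.solve-∀

Σ-Digit-single : ∀ e {s : Digit → ℕ} → (∀ d → d ≢ e → s d ≡ 0) → Σ-Digit s ≡ s e
Σ-Digit-single pos s≗0 rewrite s≗0 zer (λ ()) | s≗0 neg (λ ()) = trans (+-identityʳ _) (+-identityʳ _)
Σ-Digit-single zer s≗0 rewrite s≗0 pos (λ ()) | s≗0 neg (λ ()) = +-identityʳ _
Σ-Digit-single neg s≗0 rewrite s≗0 pos (λ ()) | s≗0 zer (λ ()) = refl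

Σ-Digit-negate : (s : Digit → ℕ) → Σ-Digit (s ∘ negateDigit) ≡ Σ-Digit s
Σ-Digit-negate s = reverse (s pos) (s zer) (s neg)
  where
  reverse : ∀ x y z → z + y + x ≡ x + y + z
  reverse = ℕ-Solver.solve-∀

Σ-BSD : (m : ℕ) → (Vec Digit m → ℕ) → ℕ
Σ-BSD zero    f = f []
Σ-BSD (suc m) f = Σ-Digit λ d → Σ-BSD m (f ∘ (d ∷_))

Σ-BSD-cong : {f g : Vec Digit m → ℕ} → (∀ ds → f ds ≡ g ds) → Σ-BSD m f ≡ Σ-BSD m g
Σ-BSD-cong {zero}  f≗g = f≗g []
Σ-BSD-cong {suc m} f≗g = Σ-Digit-cong λ d → Σ-BSD-cong (f≗g ∘ (d ∷_))

Σ-BSD-zero : {f : Vec Digit m → ℕ} → (∀ ds → f ds ≡ 0) → Σ-BSD m f ≡ 0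
Σ-BSD-zero {zero}  f≗0 = f≗0 []
Σ-BSD-zero {suc m} f≗0 = Σ-Digit-cong (λ d → Σ-BSD-zero (f≗0 ∘ (d ∷_)))

Σ-BSD-unique : (z : Vec Digit m) {f : Vec Digit m → ℕ} →
  (∀ ds → ds ≢ z → f ds ≡ 0) → Σ-BSD m f ≡ f z
Σ-BSD-unique []      f≗0 = refl
Σ-BSD-unique (e ∷ z) f≗0 = trans
  (Σ-Digit-single e (λ d d≢e → Σ-BSD-zero (λ ds → f≗0 (d ∷ ds) (d≢e ∘ cong Vec.head))))
  (Σ-BSD-unique z (λ ds ds≢z → f≗0 (e ∷ ds) (ds≢z ∘ cong Vec.tail)))

Σ-BSD-∷ʳ : (f : Vec Digit (suc m) → ℕ) → Σ-BSD (suc m) f ≡ Σ-Digit λ d → Σ-BSD m (f ∘ (_∷ʳ d))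
Σ-BSD-∷ʳ {zero}  f = refl
Σ-BSD-∷ʳ {suc m} f = trans (Σ-Digit-cong λ d → Σ-BSD-∷ʳ (f ∘ (d ∷_)))
                           (Σ-Digit-comm λ d e → Σ-BSD m (λ ds → f (d ∷ (ds ∷ʳ e))))

Σ-BSD-negate : (f : Vec Digit m → ℕ) → Σ-BSD m (f ∘ negate) ≡ Σ-BSD m f
Σ-BSD-negate {zero}  f = refl
Σ-BSD-negate {suc m} f = trans (Σ-Digit-cong λ d → Σ-BSD-negate (f ∘ (negateDigit d ∷_)))
                               (Σ-Digit-negate λ d → Σ-BSD m (f ∘ (d ∷_)))

sum-map-allBSD : ∀ m (f : Vec Digit m → ℕ) → sum (map f (allBSD m)) ≡ Σ-BSD m f
sum-map-allBSD zero    f = +-identityʳ (f [])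
sum-map-allBSD (suc m) f =
  trans (extend-sum (allBSD m)) (Σ-Digit-cong λ d → sum-map-allBSD m (f ∘ (d ∷_)))
  where
  extensions : Vec Digit m → List (Vec Digit (suc m))
  extensions ds = (pos ∷ ds) ∷ (zer ∷ ds) ∷ (neg ∷ ds) ∷ []
  extend-sum : (L : List (Vec Digit m)) →
    sum (map f (concatMap extensions L)) ≡ Σ-Digit λ d → sum (map (f ∘ (d ∷_)) L)
  extend-sum []       = refl
  extend-sum (ds ∷ L) =
    trans (cong (λ s → f (pos ∷ ds) + (f (zer ∷ ds) + (f (neg ∷ ds) + s))) (extend-sum L))
          (interleave (f (pos ∷ ds)) (f (zer ∷ ds)) (f (neg ∷ ds)) _ _ _)
    where
    interleave : ∀ x y z a b c → x + (y + (z + (a + b + c))) ≡ x + a + (y + b) + (z + c)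
    interleave = ℕ-Solver.solve-∀

count-as-sum : {A : Set} (p : A → Bool) (xs : List A) → count p xs ≡ sum (map (boolToℕ ∘ p) xs)
count-as-sum p []       = refl
count-as-sum p (x ∷ xs) = cong (_+_ (boolToℕ (p x))) (count-as-sum p xs)

sum-map-filterᵇ : {A : Set} (p : A → Bool) (f : A → ℕ) (xs : List A) →
  sum (map f (filterᵇ p xs)) ≡ sum (map (λ x → if p x then f x else 0) xs)
sum-map-filterᵇ p f []       = refl
sum-map-filterᵇ p f (x ∷ xs) with p x
... | true  = cong (_+_ (f x)) (sum-map-filterᵇ p f xs)
... | false = sum-map-filterᵇ p f xs

sum-applyUpTo-zero : ∀ N (g F : ℕ → ℕ) → (∀ j → F (g j) ≡ 0) → sum (map F (applyUpTo g N)) ≡ 0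
sum-applyUpTo-zero zero    g F F≗0 = refl
sum-applyUpTo-zero (suc N) g F F≗0 rewrite F≗0 0 = sum-applyUpTo-zero N (g ∘ suc) F (F≗0 ∘ suc)

sum-applyUpTo-single : ∀ N k (g F : ℕ → ℕ) → k < N → (∀ j → j ≢ k → F (g j) ≡ 0) →
  sum (map F (applyUpTo g N)) ≡ F (g k)
sum-applyUpTo-single (suc N) zero    g F _         F≗0 =
  trans (cong (_+_ (F (g 0))) (sum-applyUpTo-zero N (g ∘ suc) F (λ j → F≗0 (suc j) (λ ())))) (+-identityʳ _)
sum-applyUpTo-single (suc N) (suc k) g F (s≤s k<N) F≗0 rewrite F≗0 0 (λ ()) =
  sum-applyUpTo-single N k (g ∘ suc) F k<N (λ j j≢k → F≗0 (suc j) (j≢k ∘ suc-injective))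

pow2 : ℕ → ℤ
pow2 m = + (2 ^ m)

pow2-suc : ∀ m → pow2 (suc m) ≡ + 2 ℤ.* pow2 m
pow2-suc m = ℤP.pos-* 2 (2 ^ m)

2^-suc : ∀ n → 2 ^ suc n ≡ 2 ^ n + 2 ^ n
2^-suc n = cong (_+_ (2 ^ n)) (+-identityʳ (2 ^ n))

n<2^n : ∀ n → n < 2 ^ n
n<2^n zero    = s≤s z≤n
n<2^n (suc n) = begin-strict
  suc n               ≡⟨ +-comm 1 n ⟩
  n + 1               <⟨ +-mono-<-≤ (n<2^n n) (m^n>0 2 n) ⟩
  2 ^ n + 2 ^ n       ≡⟨ 2^-suc n ⟨
  2 ^ suc n           ∎
  where open ≤-Reasoning

pos-∸ : ∀ {m n} → n ≤ m → + (m ∸ n) ≡ + m ℤ.- + n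
pos-∸ {m} {n} n≤m = sym (trans (ℤP.m-n≡m⊖n m n) (ℤP.⊖-≥ n≤m))

value-∷ʳ : (ds : Vec Digit m) (d : Digit) → value (ds ∷ʳ d) ≡ value ds ℤ.+ digitVal d ℤ.* pow2 m
value-∷ʳ []       d = base (digitVal d)
  where
  base : ∀ x → x ℤ.+ + 2 ℤ.* + 0 ≡ + 0 ℤ.+ x ℤ.* + 1
  base = ℤ-Solver.solve-∀
value-∷ʳ {suc m} (e ∷ ds) d = begin
  digitVal e ℤ.+ + 2 ℤ.* value (ds ∷ʳ d)
    ≡⟨ cong (λ v → digitVal e ℤ.+ + 2 ℤ.* v) (value-∷ʳ ds d) ⟩
  digitVal e ℤ.+ + 2 ℤ.* (value ds ℤ.+ digitVal d ℤ.* pow2 m)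
    ≡⟨ step (digitVal e) (value ds) (digitVal d) (pow2 m) ⟩
  value (e ∷ ds) ℤ.+ digitVal d ℤ.* (+ 2 ℤ.* pow2 m)
    ≡⟨ cong (λ p → value (e ∷ ds) ℤ.+ digitVal d ℤ.* p) (pow2-suc m) ⟨
  value (e ∷ ds) ℤ.+ digitVal d ℤ.* pow2 (suc m) ∎
  where
  open ≡-Reasoning
  step : ∀ e v d p → e ℤ.+ + 2 ℤ.* (v ℤ.+ d ℤ.* p) ≡ e ℤ.+ + 2 ℤ.* v ℤ.+ d ℤ.* (+ 2 ℤ.* p)
  step = ℤ-Solver.solve-∀

value-∷ʳ-zer : (z : Vec Digit m) → value (z ∷ʳ zer) ≡ value z
value-∷ʳ-zer z = trans (value-∷ʳ z zer) (ℤP.+-identityʳ (value z))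

value-∷ʳ-pos : (z : Vec Digit m) → value (z ∷ʳ pos) ≡ value z ℤ.+ pow2 m
value-∷ʳ-pos {m} z = trans (value-∷ʳ z pos) (cong (ℤ._+_ (value z)) (ℤP.*-identityˡ (pow2 m)))

value-∷ʳ-neg : (z : Vec Digit m) → value (z ∷ʳ neg) ≡ value z ℤ.- pow2 m
value-∷ʳ-neg {m} z = trans (value-∷ʳ z neg) (cong (ℤ._+_ (value z)) (ℤP.-1*i≡-i (pow2 m)))

value-∷ʳ-neg-via-pos : (y : Vec Digit m) → value (y ∷ʳ neg) ≡ value (y ∷ʳ pos) ℤ.- pow2 (suc m)
value-∷ʳ-neg-via-pos {m} y = begin
  value (y ∷ʳ neg)                           ≡⟨ value-∷ʳ-neg y ⟩
  value y ℤ.- pow2 m                         ≡⟨ rebalance (value y) (pow2 m) ⟩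
  value y ℤ.+ pow2 m ℤ.- + 2 ℤ.* pow2 m      ≡⟨ cong₂ ℤ._-_ (value-∷ʳ-pos y) (pow2-suc m) ⟨
  value (y ∷ʳ pos) ℤ.- pow2 (suc m)          ∎
  where
  open ≡-Reasoning
  rebalance : ∀ v p → v ℤ.- p ≡ v ℤ.+ p ℤ.- + 2 ℤ.* p
  rebalance = ℤ-Solver.solve-∀

value-∷ʳ-zer-∷ʳ-pos : (z : Vec Digit m) → value ((z ∷ʳ zer) ∷ʳ pos) ≡ pow2 (suc m) ℤ.+ value z
value-∷ʳ-zer-∷ʳ-pos {m} z = trans (value-∷ʳ-pos (z ∷ʳ zer))
  (trans (cong (ℤ._+ pow2 (suc m)) (value-∷ʳ-zer z)) (ℤP.+-comm (value z) (pow2 (suc m))))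

weight-∷ʳ : (ds : Vec Digit m) (d : Digit) → weight (ds ∷ʳ d) ≡ digitWeight d + weight ds
weight-∷ʳ []       d = refl
weight-∷ʳ (e ∷ ds) d =
  trans (cong (_+_ (digitWeight e)) (weight-∷ʳ ds d)) (swap (digitWeight e) (digitWeight d) (weight ds))
  where
  swap : ∀ x y z → x + (y + z) ≡ y + (x + z)
  swap = ℕ-Solver.solve-∀

weight-∷ʳ-neg : (y : Vec Digit m) → weight (y ∷ʳ neg) ≡ weight (y ∷ʳ pos)
weight-∷ʳ-neg y = trans (weight-∷ʳ y neg) (sym (weight-∷ʳ y pos))

weight-∷ʳ-zer-∷ʳ : (z : Vec Digit m) (d : Digit) → weight ((z ∷ʳ zer) ∷ʳ d) ≡ digitWeight d + weight z
weight-∷ʳ-zer-∷ʳ z d = trans (weight-∷ʳ (z ∷ʳ zer) d) (cong (_+_ (digitWeight d)) (weight-∷ʳ z zer))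

digitVal-negate : ∀ d → digitVal (negateDigit d) ≡ - digitVal d
digitVal-negate pos = refl
digitVal-negate zer = refl
digitVal-negate neg = refl

value-negate : (ds : Vec Digit m) → value (negate ds) ≡ - value ds
value-negate []       = refl
value-negate (d ∷ ds) = trans (cong₂ (λ x v → x ℤ.+ + 2 ℤ.* v) (digitVal-negate d) (value-negate ds))
                              (distrib (digitVal d) (value ds))
  where
  distrib : ∀ x v → - x ℤ.+ + 2 ℤ.* - v ≡ - (x ℤ.+ + 2 ℤ.* v)
  distrib = ℤ-Solver.solve-∀

weight-negate : (ds : Vec Digit m) → weight (negate ds) ≡ weight ds
weight-negate []         = refl
weight-negate (pos ∷ ds) = cong suc (weight-negate ds)
weight-negate (zer ∷ ds) = weight-negate ds
weight-negate (neg ∷ ds) = cong suc (weight-negate ds)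

digitSlack : Digit → ℕ
digitSlack pos = 0
digitSlack zer = 1
digitSlack neg = 2

value-gap : (ds : Vec Digit m) → ∃[ s ] value ds ℤ.+ + suc s ≡ pow2 m
value-gap []                 = 0 , refl
value-gap {suc m} (d ∷ ds) with value-gap ds
... | s , gap = digitSlack d + 2 * s , (begin
  digitVal d ℤ.+ + 2 ℤ.* value ds ℤ.+ + suc (digitSlack d + 2 * s)
    ≡⟨ cong (λ k → digitVal d ℤ.+ + 2 ℤ.* value ds ℤ.+ (+ 1 ℤ.+ k))
            (trans (ℤP.pos-+ (digitSlack d) (2 * s)) (cong (ℤ._+_ (+ digitSlack d)) (ℤP.pos-* 2 s))) ⟩
  digitVal d ℤ.+ + 2 ℤ.* value ds ℤ.+ (+ 1 ℤ.+ (+ digitSlack d ℤ.+ + 2 ℤ.* + s))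
    ≡⟨ doubled d (value ds) (+ s) ⟩
  + 2 ℤ.* (value ds ℤ.+ + suc s)
    ≡⟨ cong (ℤ._*_ (+ 2)) gap ⟩
  + 2 ℤ.* pow2 m
    ≡⟨ pow2-suc m ⟨
  pow2 (suc m) ∎)
  where
  open ≡-Reasoning
  doubled : ∀ d v s →
    digitVal d ℤ.+ + 2 ℤ.* v ℤ.+ (+ 1 ℤ.+ (+ digitSlack d ℤ.+ + 2 ℤ.* s)) ≡ + 2 ℤ.* (v ℤ.+ (+ 1 ℤ.+ s))
  doubled pos = ℤ-Solver.solve-∀
  doubled zer = ℤ-Solver.solve-∀
  doubled neg = ℤ-Solver.solve-∀

value-<-2^ : (z : Vec Digit m) → value z ≡ + n → n < 2 ^ m
value-<-2^ {m} {n} z vz with value-gap z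
... | s , gap = subst (n <_) (ℤP.+-injective (trans (cong (ℤ._+ + suc s) (sym vz)) gap))
                      (≤-trans (≤-reflexive (+-comm 1 n)) (+-monoʳ-≤ n (s≤s z≤n)))

value-≢-above : (ds : Vec Digit m) (t : ℕ) → value ds ≢ pow2 m ℤ.+ + t
value-≢-above {m} ds t v≡ =
  <⇒≱ (value-<-2^ ds (trans v≡ (sym (ℤP.pos-+ (2 ^ m) t)))) (m≤m+n (2 ^ m) t)

IsRep : ℤ → ℕ → Vec Digit m → Set
IsRep x w ds = value ds ≡ x × weight ds ≡ w

isRep? : ∀ x w (ds : Vec Digit m) → Dec (IsRep x w ds)
isRep? x w ds = value ds ℤ.≟ x ×-dec weight ds ≟ w

repIndicator : ℤ → ℕ → Vec Digit m → ℕ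
repIndicator x w ds = boolToℕ (does (isRep? x w ds))

reps : (m : ℕ) → ℤ → ℕ → ℕ
reps m x w = Σ-BSD m (repIndicator x w)

repsOfWeight≡reps : ∀ m n w → repsOfWeight m n w ≡ reps m (+ n) w
repsOfWeight≡reps m n w = begin
  count isWeightRep (allBSD m)                 ≡⟨ count-as-sum isWeightRep (allBSD m) ⟩
  sum (map (boolToℕ ∘ isWeightRep) (allBSD m)) ≡⟨ sum-map-allBSD m (boolToℕ ∘ isWeightRep) ⟩
  Σ-BSD m (boolToℕ ∘ isWeightRep)              ≡⟨ Σ-BSD-cong {m} (λ ds → cong boolToℕ
                                                    (cong₂ _∧_ (isYes≗does (value ds ℤ.≟ + n))
                                                               (isYes≗does (weight ds ≟ w)))) ⟩
  reps m (+ n) w                               ∎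
  where
  open ≡-Reasoning
  isWeightRep : Vec Digit m → Bool
  isWeightRep ds = represents n ds ∧ ⌊ weight ds ≟ w ⌋

repIndicator-⇔ : ∀ {x x′ w w′} (ds : Vec Digit m) (ds′ : Vec Digit n) →
  IsRep x w ds ⇔ IsRep x′ w′ ds′ → repIndicator x w ds ≡ repIndicator x′ w′ ds′
repIndicator-⇔ {x = x} {x′} {w} {w′} ds ds′ equiv =
  cong boolToℕ (does-⇔ equiv (isRep? x w ds) (isRep? x′ w′ ds′))

repIndicator-¬ : ∀ {x w} (ds : Vec Digit m) → ¬ IsRep x w ds → repIndicator x w ds ≡ 0
repIndicator-¬ {x = x} {w} ds ¬rep = cong boolToℕ (dec-false (isRep? x w ds) ¬rep)

reps-negate : ∀ m x w → reps m (- x) w ≡ reps m x w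
reps-negate m x w = trans (sym (Σ-BSD-negate {m} (repIndicator (- x) w)))
  (Σ-BSD-cong {m} λ ds → repIndicator-⇔ (negate ds) ds (mk⇔
    (λ (v , wt) → ℤP.neg-injective (trans (sym (value-negate ds)) v) , trans (sym (weight-negate ds)) wt)
    (λ (v , wt) → trans (value-negate ds) (cong -_ v) , trans (weight-negate ds) wt)))

reps-above : ∀ m t w → reps m (pow2 m ℤ.+ + t) w ≡ 0
reps-above m t w = Σ-BSD-zero {m} λ ds → repIndicator-¬ ds λ (v , _) → value-≢-above ds t v

shift-⇔ : ∀ (a q x : ℤ) → (a ℤ.+ q ≡ x) ⇔ (a ≡ x ℤ.- q)
shift-⇔ a q x = mk⇔ (λ eq → trans (addSub a q) (cong (ℤ._- q) eq))
                     (λ eq → trans (cong (ℤ._+ q) eq) (subAdd x q))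
  where
  addSub : ∀ a q → a ≡ a ℤ.+ q ℤ.- q
  addSub = ℤ-Solver.solve-∀
  subAdd : ∀ x q → x ℤ.- q ℤ.+ q ≡ x
  subAdd = ℤ-Solver.solve-∀

IsRep-∷ʳ : ∀ {x x′ w} (ds : Vec Digit m) d → x′ ≡ x ℤ.- digitVal d ℤ.* pow2 m →
  IsRep x (digitWeight d + w) (ds ∷ʳ d) ⇔ IsRep x′ w ds
IsRep-∷ʳ {m} {x} {x′} {w} ds d x′≡ = mk⇔
  (λ (v , wt) → trans (Equivalence.to (shift-⇔ _ _ x) (trans (sym (value-∷ʳ ds d)) v)) (sym x′≡)
              , +-cancelˡ-≡ (digitWeight d) _ _ (trans (sym (weight-∷ʳ ds d)) wt))
  (λ (v , wt) → trans (value-∷ʳ ds d) (Equivalence.from (shift-⇔ _ _ x) (trans v x′≡))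
              , trans (weight-∷ʳ ds d) (cong (_+_ (digitWeight d)) wt))

reps-fixing-top : ∀ m d x {x′ w} → x′ ≡ x ℤ.- digitVal d ℤ.* pow2 m →
  Σ-BSD m (λ ds → repIndicator x (digitWeight d + w) (ds ∷ʳ d)) ≡ reps m x′ w
reps-fixing-top m d x x′≡ = Σ-BSD-cong {m} λ ds → repIndicator-⇔ (ds ∷ʳ d) ds (IsRep-∷ʳ ds d x′≡)

reps-fixing-top-zer : ∀ m x w → Σ-BSD m (λ ds → repIndicator x w (ds ∷ʳ zer)) ≡ reps m x w
reps-fixing-top-zer m x w = reps-fixing-top m zer x (subtractZero x (pow2 m))
  where
  subtractZero : ∀ x p → x ≡ x ℤ.- + 0 ℤ.* p
  subtractZero = ℤ-Solver.solve-∀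

reps-∷ʳ : ∀ m x w →
  reps (suc m) x (suc w) ≡ reps m (x ℤ.- pow2 m) w + reps m x (suc w) + reps m (x ℤ.+ pow2 m) w
reps-∷ʳ m x w = trans (Σ-BSD-∷ʳ {m} (repIndicator x (suc w)))
  (cong₂ _+_ (cong₂ _+_ (reps-fixing-top m pos x (cong (ℤ._-_ x) (sym (ℤP.*-identityˡ (pow2 m)))))
                        (reps-fixing-top-zer m x (suc w)))
             (reps-fixing-top m neg x (addBack x (pow2 m))))
  where
  addBack : ∀ x p → x ℤ.+ p ≡ x ℤ.- -[1+ 0 ] ℤ.* p
  addBack = ℤ-Solver.solve-∀

reps-∷ʳ-zero : ∀ m x → reps (suc m) x 0 ≡ reps m x 0
reps-∷ʳ-zero m x = begin
  reps (suc m) x 0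
    ≡⟨ Σ-BSD-∷ʳ {m} (repIndicator x 0) ⟩
  Σ-BSD m (top pos) + Σ-BSD m (top zer) + Σ-BSD m (top neg)
    ≡⟨ cong₂ _+_ (cong₂ _+_ (nonzeroTop pos refl) (reps-fixing-top-zer m x 0)) (nonzeroTop neg refl) ⟩
  0 + reps m x 0 + 0
    ≡⟨ +-identityʳ _ ⟩
  reps m x 0 ∎
  where
  open ≡-Reasoning
  top : Digit → Vec Digit m → ℕ
  top d ds = repIndicator x 0 (ds ∷ʳ d)
  nonzeroTop : ∀ d → digitWeight d ≡ 1 → Σ-BSD m (top d) ≡ 0
  nonzeroTop d w≡1 = Σ-BSD-zero {m} λ ds → repIndicator-¬ (ds ∷ʳ d) λ (_ , wt) →
    1+n≢0 (trans (cong (_+ weight ds) (sym w≡1)) (trans (sym (weight-∷ʳ ds d)) wt))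

NAF : Vec Digit m → Set
NAF z = T (isNAF z)

lowestDigit : Vec Digit m → Digit
lowestDigit []      = zer
lowestDigit (d ∷ _) = d

lastDigit : Vec Digit m → Digit
lastDigit []           = zer
lastDigit (d ∷ [])     = d
lastDigit (_ ∷ e ∷ ds) = lastDigit (e ∷ ds)

naf-tail : ∀ e (z : Vec Digit m) → NAF (e ∷ z) → NAF z
naf-tail e []      _   = _
naf-tail e (d ∷ z) naf = proj₂ (Equivalence.to T-∧ naf)

naf-after-nonzero : ∀ e (z : Vec Digit m) → NAF (e ∷ z) → T (nonzero e) → lowestDigit z ≡ zer
naf-after-nonzero pos []        _  _ = refl
naf-after-nonzero pos (zer ∷ _) _  _ = refl
naf-after-nonzero pos (pos ∷ _) () _
naf-after-nonzero pos (neg ∷ _) () _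
naf-after-nonzero neg []        _  _ = refl
naf-after-nonzero neg (zer ∷ _) _  _ = refl
naf-after-nonzero neg (pos ∷ _) () _
naf-after-nonzero neg (neg ∷ _) () _

even-after-zer : (z : Vec Digit m) → lowestDigit z ≡ zer → ∃[ h ] value z ≡ + 0 ℤ.+ + 2 ℤ.* h
even-after-zer []      _    = + 0 , refl
even-after-zer (zer ∷ z) _  = value z , refl

lastDigit-∷ʳ : (z : Vec Digit m) (d : Digit) → lastDigit (z ∷ʳ d) ≡ d
lastDigit-∷ʳ []           d = refl
lastDigit-∷ʳ (_ ∷ [])     d = refl
lastDigit-∷ʳ (_ ∷ e ∷ ds) d = lastDigit-∷ʳ (e ∷ ds) d

leadingNonzero-∷ʳ : (z : Vec Digit m) (d : Digit) → leadingNonzero (z ∷ʳ d) ≡ nonzero d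
leadingNonzero-∷ʳ []           d = refl
leadingNonzero-∷ʳ (_ ∷ [])     d = refl
leadingNonzero-∷ʳ (_ ∷ e ∷ ds) d = leadingNonzero-∷ʳ (e ∷ ds) d

leading-∷ʳ-pos : (z : Vec Digit m) → T (leadingNonzero (z ∷ʳ pos))
leading-∷ʳ-pos z = subst T (sym (leadingNonzero-∷ʳ z pos)) _

isNAF-∷ʳ : (z : Vec Digit m) (d : Digit) →
  isNAF (z ∷ʳ d) ≡ not (nonzero d ∧ nonzero (lastDigit z)) ∧ isNAF z
isNAF-∷ʳ []           d rewrite ∧-zeroʳ (nonzero d) = refl
isNAF-∷ʳ (x ∷ [])     d = cong (λ b → not b ∧ true) (∧-comm (nonzero x) (nonzero d))
isNAF-∷ʳ (x ∷ e ∷ ds) d = trans (cong (not (nonzero x ∧ nonzero e) ∧_) (isNAF-∷ʳ (e ∷ ds) d))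
  (∧-swap (not (nonzero x ∧ nonzero e)) (not (nonzero d ∧ nonzero (lastDigit (e ∷ ds)))) (isNAF (e ∷ ds)))
  where
  ∧-swap : ∀ a b c → a ∧ (b ∧ c) ≡ b ∧ (a ∧ c)
  ∧-swap true  b c = refl
  ∧-swap false b c = sym (∧-zeroʳ b)

naf-∷ʳ-zer : (z : Vec Digit m) → NAF z → NAF (z ∷ʳ zer)
naf-∷ʳ-zer z naf = subst T (sym (isNAF-∷ʳ z zer)) naf

naf-∷ʳ-zer-∷ʳ : (z : Vec Digit m) (d : Digit) → NAF z → NAF ((z ∷ʳ zer) ∷ʳ d)
naf-∷ʳ-zer-∷ʳ z d naf = subst T (sym (begin
  isNAF ((z ∷ʳ zer) ∷ʳ d)
    ≡⟨ isNAF-∷ʳ (z ∷ʳ zer) d ⟩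
  not (nonzero d ∧ nonzero (lastDigit (z ∷ʳ zer))) ∧ isNAF (z ∷ʳ zer)
    ≡⟨ cong (λ e → not (nonzero d ∧ nonzero e) ∧ isNAF (z ∷ʳ zer)) (lastDigit-∷ʳ z zer) ⟩
  not (nonzero d ∧ false) ∧ isNAF (z ∷ʳ zer)
    ≡⟨ cong (λ b → not b ∧ isNAF (z ∷ʳ zer)) (∧-zeroʳ (nonzero d)) ⟩
  isNAF (z ∷ʳ zer)
    ≡⟨ isNAF-∷ʳ z zer ⟩
  isNAF z ∎)) naf
  where open ≡-Reasoning

naf-∷ʳ-swap : (z : Vec Digit m) {d d′ : Digit} → nonzero d ≡ nonzero d′ →
  NAF (z ∷ʳ d) → NAF (z ∷ʳ d′)
naf-∷ʳ-swap z {d} {d′} same naf = subst T (trans (isNAF-∷ʳ z d)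
  (trans (cong (λ b → not (b ∧ nonzero (lastDigit z)) ∧ isNAF z) same) (sym (isNAF-∷ʳ z d′)))) naf

naf-negate : (z : Vec Digit m) → NAF z → NAF (negate z)
naf-negate z = subst T (sym (isNAF-negate z))
  where
  nonzero-negate : ∀ d → nonzero (negateDigit d) ≡ nonzero d
  nonzero-negate pos = refl
  nonzero-negate zer = refl
  nonzero-negate neg = refl
  isNAF-negate : (z : Vec Digit m) → isNAF (negate z) ≡ isNAF z
  isNAF-negate []           = refl
  isNAF-negate (_ ∷ [])     = refl
  isNAF-negate (x ∷ e ∷ ds) = cong₂ _∧_ (cong not (cong₂ _∧_ (nonzero-negate x) (nonzero-negate e)))
                                       (isNAF-negate (e ∷ ds))

naf-below-top : (y : Vec Digit m) (e d : Digit) → NAF ((y ∷ʳ e) ∷ʳ d) → T (nonzero d) → e ≡ zer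
naf-below-top y e d naf d≢0 = below e d (proj₁ (Equivalence.to T-∧ (subst T eq naf))) d≢0
  where
  eq : isNAF ((y ∷ʳ e) ∷ʳ d) ≡ not (nonzero d ∧ nonzero e) ∧ isNAF (y ∷ʳ e)
  eq = trans (isNAF-∷ʳ (y ∷ʳ e) d)
             (cong (λ x → not (nonzero d ∧ nonzero x) ∧ isNAF (y ∷ʳ e)) (lastDigit-∷ʳ y e))
  below : ∀ e d → T (not (nonzero d ∧ nonzero e)) → T (nonzero d) → e ≡ zer
  below zer d _ _ = refl
  below pos pos () _
  below pos neg () _
  below neg pos () _
  below neg neg () _

-- Minimality and uniqueness of NAFs

halve : ∀ (d c e c′ x y : ℤ) → d ℤ.+ c ≡ e ℤ.+ + 2 ℤ.* c′ →
  e ℤ.+ + 2 ℤ.* x ≡ d ℤ.+ + 2 ℤ.* y ℤ.+ c → x ≡ y ℤ.+ c′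
halve d c e c′ x y adder eq = ℤP.*-cancelˡ-≡ (+ 2) x (y ℤ.+ c′) (begin
  + 2 ℤ.* x                             ≡⟨ isolate e x ⟩
  e ℤ.+ + 2 ℤ.* x ℤ.- e                 ≡⟨ cong (ℤ._- e) eq ⟩
  d ℤ.+ + 2 ℤ.* y ℤ.+ c ℤ.- e           ≡⟨ regroup d y c e ⟩
  + 2 ℤ.* y ℤ.+ (d ℤ.+ c) ℤ.- e         ≡⟨ cong (λ s → + 2 ℤ.* y ℤ.+ s ℤ.- e) adder ⟩
  + 2 ℤ.* y ℤ.+ (e ℤ.+ + 2 ℤ.* c′) ℤ.- e ≡⟨ collect y e c′ ⟩
  + 2 ℤ.* (y ℤ.+ c′)                    ∎)
  where
  open ≡-Reasoning
  isolate : ∀ e x → + 2 ℤ.* x ≡ e ℤ.+ + 2 ℤ.* x ℤ.- e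
  isolate = ℤ-Solver.solve-∀
  regroup : ∀ d y c e → d ℤ.+ + 2 ℤ.* y ℤ.+ c ℤ.- e ≡ + 2 ℤ.* y ℤ.+ (d ℤ.+ c) ℤ.- e
  regroup = ℤ-Solver.solve-∀
  collect : ∀ y e c′ → + 2 ℤ.* y ℤ.+ (e ℤ.+ + 2 ℤ.* c′) ℤ.- e ≡ + 2 ℤ.* (y ℤ.+ c′)
  collect = ℤ-Solver.solve-∀

two-times-≢-one : ∀ k → + 2 ℤ.* k ≢ + 1
two-times-≢-one (+ zero)  ()
two-times-≢-one +[1+ n ]  eq = m+1+n≢0 n (suc-injective (ℤP.+-injective eq))
two-times-≢-one -[1+ n ]  ()

odd-defect : ∀ d c e (x y : ℤ) t →
  digitVal d ℤ.+ digitVal c ≡ digitVal e ℤ.+ (+ 1 ℤ.+ + 2 ℤ.* t) →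
  digitVal e ℤ.+ + 2 ℤ.* x ≡ digitVal d ℤ.+ + 2 ℤ.* y ℤ.+ digitVal c → ⊥
odd-defect d c e x y t defect eq = two-times-≢-one (x ℤ.- y ℤ.- t) (begin
  + 2 ℤ.* (x ℤ.- y ℤ.- t)
    ≡⟨ expand ε x y t ⟩
  ε ℤ.+ + 2 ℤ.* x ℤ.- ε ℤ.- + 2 ℤ.* y ℤ.- + 2 ℤ.* t
    ≡⟨ cong (λ s → s ℤ.- ε ℤ.- + 2 ℤ.* y ℤ.- + 2 ℤ.* t) eq ⟩
  δ ℤ.+ + 2 ℤ.* y ℤ.+ γ ℤ.- ε ℤ.- + 2 ℤ.* y ℤ.- + 2 ℤ.* t
    ≡⟨ regroup δ y γ ε t ⟩
  δ ℤ.+ γ ℤ.- ε ℤ.- + 2 ℤ.* t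
    ≡⟨ cong (λ s → s ℤ.- ε ℤ.- + 2 ℤ.* t) defect ⟩
  ε ℤ.+ (+ 1 ℤ.+ + 2 ℤ.* t) ℤ.- ε ℤ.- + 2 ℤ.* t
    ≡⟨ collapse ε t ⟩
  + 1 ∎)
  where
  open ≡-Reasoning
  δ : ℤ
  δ = digitVal d
  γ : ℤ
  γ = digitVal c
  ε : ℤ
  ε = digitVal e
  expand : ∀ e x y t → + 2 ℤ.* (x ℤ.- y ℤ.- t) ≡ e ℤ.+ + 2 ℤ.* x ℤ.- e ℤ.- + 2 ℤ.* y ℤ.- + 2 ℤ.* t
  expand = ℤ-Solver.solve-∀
  regroup : ∀ d y c e t →
    d ℤ.+ + 2 ℤ.* y ℤ.+ c ℤ.- e ℤ.- + 2 ℤ.* y ℤ.- + 2 ℤ.* t ≡ d ℤ.+ c ℤ.- e ℤ.- + 2 ℤ.* t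
  regroup = ℤ-Solver.solve-∀
  collapse : ∀ e t → e ℤ.+ (+ 1 ℤ.+ + 2 ℤ.* t) ℤ.- e ℤ.- + 2 ℤ.* t ≡ + 1
  collapse = ℤ-Solver.solve-∀

-- The carry is free where the NAF digit is 0.  The plain bound |c| does not survive the
-- induction: 1 = −1 + 2·1 keeps a nonzero digit and creates a carry, which is repaid only at the
-- next NAF digit, necessarily 0.
carryCost : Digit → Digit → ℕ
carryCost e c = if nonzero e then digitWeight c else 0

carry : ∀ d c e x y → digitVal e ℤ.+ + 2 ℤ.* x ≡ digitVal d ℤ.+ + 2 ℤ.* y ℤ.+ digitVal c →
  Σ[ c′ ∈ Digit ] digitVal d ℤ.+ digitVal c ≡ digitVal e ℤ.+ + 2 ℤ.* digitVal c′
                × digitWeight e + (if nonzero e then 0 else digitWeight c′) ≤ digitWeight d + carryCost e c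
carry pos pos pos x y eq = ⊥-elim (odd-defect pos pos pos x y (+ 0) refl eq)
carry pos pos zer _ _ _  = pos , refl , s≤s z≤n
carry pos pos neg x y eq = ⊥-elim (odd-defect pos pos neg x y (+ 1) refl eq)
carry pos zer pos _ _ _  = zer , refl , s≤s z≤n
carry pos zer zer x y eq = ⊥-elim (odd-defect pos zer zer x y (+ 0) refl eq)
carry pos zer neg _ _ _  = pos , refl , s≤s z≤n
carry pos neg pos x y eq = ⊥-elim (odd-defect pos neg pos x y (- + 1) refl eq)
carry pos neg zer _ _ _  = zer , refl , z≤n
carry pos neg neg x y eq = ⊥-elim (odd-defect pos neg neg x y (+ 0) refl eq)
carry zer pos pos _ _ _  = zer , refl , s≤s z≤n
carry zer pos zer x y eq = ⊥-elim (odd-defect zer pos zer x y (+ 0) refl eq)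
carry zer pos neg _ _ _  = pos , refl , s≤s z≤n
carry zer zer pos x y eq = ⊥-elim (odd-defect zer zer pos x y (- + 1) refl eq)
carry zer zer zer _ _ _  = zer , refl , z≤n
carry zer zer neg x y eq = ⊥-elim (odd-defect zer zer neg x y (+ 0) refl eq)
carry zer neg pos _ _ _  = neg , refl , s≤s z≤n
carry zer neg zer x y eq = ⊥-elim (odd-defect zer neg zer x y (- + 1) refl eq)
carry zer neg neg _ _ _  = zer , refl , s≤s z≤n
carry neg pos pos x y eq = ⊥-elim (odd-defect neg pos pos x y (- + 1) refl eq)
carry neg pos zer _ _ _  = zer , refl , z≤n
carry neg pos neg x y eq = ⊥-elim (odd-defect neg pos neg x y (+ 0) refl eq)
carry neg zer pos _ _ _  = neg , refl , s≤s z≤n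
carry neg zer zer x y eq = ⊥-elim (odd-defect neg zer zer x y (- + 1) refl eq)
carry neg zer neg _ _ _  = zer , refl , s≤s z≤n
carry neg neg pos x y eq = ⊥-elim (odd-defect neg neg pos x y (- + 2) refl eq)
carry neg neg zer _ _ _  = neg , refl , s≤s z≤n
carry neg neg neg x y eq = ⊥-elim (odd-defect neg neg neg x y (- + 1) refl eq)

carryCost-≤ : ∀ e c → carryCost e c ≤ digitWeight c
carryCost-≤ e c with nonzero e
... | true  = ≤-refl
... | false = z≤n

carryCost-zer : ∀ e → carryCost e zer ≡ 0
carryCost-zer pos = refl
carryCost-zer zer = refl
carryCost-zer neg = refl

carryCost-after : ∀ e (z : Vec Digit m) c′ → NAF (e ∷ z) →
  carryCost (lowestDigit z) c′ ≤ (if nonzero e then 0 else digitWeight c′)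
carryCost-after pos z c′ naf rewrite naf-after-nonzero pos z naf _ = z≤n
carryCost-after neg z c′ naf rewrite naf-after-nonzero neg z naf _ = z≤n
carryCost-after zer z c′ _   = carryCost-≤ (lowestDigit z) c′

naf-digit-step : ∀ e d c (z : Vec Digit n) (ds : Vec Digit m) → NAF (e ∷ z) →
  value (e ∷ z) ≡ value (d ∷ ds) ℤ.+ digitVal c →
  (∀ c′ → value z ≡ value ds ℤ.+ digitVal c′ → weight z ≤ weight ds + carryCost (lowestDigit z) c′) →
  weight (e ∷ z) ≤ weight (d ∷ ds) + carryCost e c
naf-digit-step e d c z ds naf eq minimal-tail with carry d c e (value z) (value ds) eq
... | c′ , adder , budget = begin
  digitWeight e + weight z
    ≤⟨ +-monoʳ-≤ (digitWeight e) (minimal-tail c′ tail-eq) ⟩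
  digitWeight e + (weight ds + carryCost (lowestDigit z) c′)
    ≤⟨ +-monoʳ-≤ (digitWeight e) (+-monoʳ-≤ (weight ds) (carryCost-after e z c′ naf)) ⟩
  digitWeight e + (weight ds + exitCost)
    ≡⟨ swap (digitWeight e) (weight ds) exitCost ⟩
  weight ds + (digitWeight e + exitCost)
    ≤⟨ +-monoʳ-≤ (weight ds) budget ⟩
  weight ds + (digitWeight d + carryCost e c)
    ≡⟨ swapAssoc (weight ds) (digitWeight d) (carryCost e c) ⟩
  digitWeight d + weight ds + carryCost e c ∎
  where
  open ≤-Reasoning
  exitCost : ℕ
  exitCost = if nonzero e then 0 else digitWeight c′
  tail-eq : value z ≡ value ds ℤ.+ digitVal c′
  tail-eq = halve (digitVal d) (digitVal c) (digitVal e) (digitVal c′) (value z) (value ds) adder eq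
  swap : ∀ a b c → a + (b + c) ≡ b + (a + c)
  swap = ℕ-Solver.solve-∀
  swapAssoc : ∀ a b c → a + (b + c) ≡ b + a + c
  swapAssoc = ℕ-Solver.solve-∀

naf-weight-minimal : (z : Vec Digit n) (ds : Vec Digit m) (c : Digit) → NAF z →
  value z ≡ value ds ℤ.+ digitVal c → weight z ≤ weight ds + carryCost (lowestDigit z) c
naf-weight-minimal []      ds       c _   _  = z≤n
naf-weight-minimal (e ∷ z) []       c naf eq =
  naf-digit-step e zer c z [] naf eq (λ c′ → naf-weight-minimal z [] c′ (naf-tail e z naf))
naf-weight-minimal (e ∷ z) (d ∷ ds) c naf eq =
  naf-digit-step e d c z ds naf eq (λ c′ → naf-weight-minimal z ds c′ (naf-tail e z naf))

naf-weight-≤ : (z : Vec Digit n) (ds : Vec Digit m) → NAF z → value z ≡ value ds → weight z ≤ weight ds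
naf-weight-≤ z ds naf eq =
  ≤-trans (naf-weight-minimal z ds zer naf (trans eq (sym (ℤP.+-identityʳ (value ds)))))
  (≤-reflexive (trans (cong (_+_ (weight ds)) (carryCost-zer (lowestDigit z))) (+-identityʳ (weight ds))))

digit-cancel : ∀ e (x y : ℤ) → digitVal e ℤ.+ + 2 ℤ.* x ≡ digitVal e ℤ.+ + 2 ℤ.* y → x ≡ y
digit-cancel e x y eq = trans
  (halve ε (+ 0) ε (+ 0) x y (trans (ℤP.+-identityʳ ε) (sym (ℤP.+-identityʳ ε)))
         (trans eq (sym (ℤP.+-identityʳ _))))
  (ℤP.+-identityʳ y)
  where
  ε : ℤ
  ε = digitVal e

naf-unique : (z y : Vec Digit m) → NAF z → NAF y → value z ≡ value y → z ≡ y
naf-unique []      []      _  _  _  = refl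
naf-unique (e ∷ z) (d ∷ y) nz ny eq = heads e d nz ny eq
  where
  same : ∀ e → NAF (e ∷ z) → NAF (e ∷ y) → value (e ∷ z) ≡ value (e ∷ y) → e ∷ z ≡ e ∷ y
  same e nz ny eq = cong (e ∷_) (naf-unique z y (naf-tail e z nz) (naf-tail e y ny) (digit-cancel e _ _ eq))
  parity : ∀ e d t → digitVal d ℤ.+ + 0 ≡ digitVal e ℤ.+ (+ 1 ℤ.+ + 2 ℤ.* t) →
    value (e ∷ z) ≡ value (d ∷ y) → ⊥
  parity e d t defect eq = odd-defect d zer e (value z) (value y) t defect (trans eq (sym (ℤP.+-identityʳ _)))
  opposite : ∀ e d c′ t → T (nonzero e) → T (nonzero d) → NAF (e ∷ z) → NAF (d ∷ y) →
    digitVal d ℤ.+ + 0 ≡ digitVal e ℤ.+ + 2 ℤ.* digitVal c′ → digitVal c′ ≡ + 1 ℤ.+ + 2 ℤ.* t →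
    value (e ∷ z) ≡ value (d ∷ y) → ⊥
  opposite e d c′ t e≢0 d≢0 nz ny adder c′-odd eq
    with even-after-zer z (naf-after-nonzero e z nz e≢0) | even-after-zer y (naf-after-nonzero d y ny d≢0)
  ... | a , za | b , yb = odd-defect zer c′ zer a b t (cong (ℤ._+_ (+ 0)) c′-odd) (begin
    + 0 ℤ.+ + 2 ℤ.* a       ≡⟨ za ⟨
    value z                 ≡⟨ halve (digitVal d) (+ 0) (digitVal e) (digitVal c′) (value z) (value y) adder
                                     (trans eq (sym (ℤP.+-identityʳ _))) ⟩
    value y ℤ.+ digitVal c′ ≡⟨ cong (ℤ._+ digitVal c′) yb ⟩
    + 0 ℤ.+ + 2 ℤ.* b ℤ.+ digitVal c′ ∎)
    where open ≡-Reasoning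
  heads : ∀ e d → NAF (e ∷ z) → NAF (d ∷ y) → value (e ∷ z) ≡ value (d ∷ y) → e ∷ z ≡ d ∷ y
  heads pos pos nz ny eq = same pos nz ny eq
  heads zer zer nz ny eq = same zer nz ny eq
  heads neg neg nz ny eq = same neg nz ny eq
  heads pos zer nz ny eq = ⊥-elim (parity pos zer (- + 1) refl eq)
  heads zer pos nz ny eq = ⊥-elim (parity zer pos (+ 0) refl eq)
  heads neg zer nz ny eq = ⊥-elim (parity neg zer (+ 0) refl eq)
  heads zer neg nz ny eq = ⊥-elim (parity zer neg (- + 1) refl eq)
  heads pos neg nz ny eq = ⊥-elim (opposite pos neg neg (- + 1) _ _ nz ny refl refl eq)
  heads neg pos nz ny eq = ⊥-elim (opposite neg pos pos (+ 0) _ _ nz ny refl refl eq)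

padZeros : (o : ℕ) → Vec Digit m → Vec Digit (o + m)
padZeros zero    z = z
padZeros (suc o) z = padZeros o z ∷ʳ zer

value-padZeros : ∀ o (z : Vec Digit m) → value (padZeros o z) ≡ value z
value-padZeros zero    z = refl
value-padZeros (suc o) z = trans (value-∷ʳ-zer (padZeros o z)) (value-padZeros o z)

naf-padZeros : ∀ o (z : Vec Digit m) → NAF z → NAF (padZeros o z)
naf-padZeros zero    z naf = naf
naf-padZeros (suc o) z naf = naf-∷ʳ-zer (padZeros o z) (naf-padZeros o z naf)

naf-not-shorter : (z : Vec Digit m) (y : Vec Digit n) → NAF z → NAF y → T (leadingNonzero y) →
  value z ≡ value y → ¬ m < n
naf-not-shorter {m} z y nz ny ly eq m<n with m≤n⇒∃[o]m+o≡n m<n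
... | o , m+o≡n = shorter o (trans (cong suc (+-comm o m)) m+o≡n) y ny ly eq
  where
  shorter : ∀ o → suc o + m ≡ n → (y : Vec Digit n) → NAF y → T (leadingNonzero y) →
    value z ≡ value y → ⊥
  shorter o refl y ny ly eq
    with naf-unique y (padZeros (suc o) z) ny (naf-padZeros (suc o) z nz)
                    (trans (sym eq) (sym (value-padZeros (suc o) z)))
  ... | refl = subst T (leadingNonzero-∷ʳ (padZeros o z) zer) ly

reduced-naf-length-unique : (z : Vec Digit m) (y : Vec Digit n) → NAF z → NAF y →
  T (leadingNonzero z) → T (leadingNonzero y) → value z ≡ value y → m ≡ n
reduced-naf-length-unique z y nz ny lz ly eq =
  ≤-antisym (≮⇒≥ (naf-not-shorter y z ny nz lz (sym eq))) (≮⇒≥ (naf-not-shorter z y nz ny ly eq))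

top-pos-lower-bound : (y : Vec Digit m) → value ((y ∷ʳ zer) ∷ʳ pos) ≡ + n → suc m ≤ n
top-pos-lower-bound {m} {n} y eq with value-gap (negate y)
... | s , gap = subst (suc m ≤_) (sym n≡) (≤-trans (n<2^n m) (m≤m+n (2 ^ m) (suc s)))
  where
  open ≡-Reasoning
  n≡ : n ≡ 2 ^ m + suc s
  n≡ = ℤP.+-injective (begin
    + n                                                  ≡⟨ eq ⟨
    value ((y ∷ʳ zer) ∷ʳ pos)                            ≡⟨ value-∷ʳ-zer-∷ʳ-pos y ⟩
    pow2 (suc m) ℤ.+ value y                             ≡⟨ cong₂ ℤ._+_ (pow2-suc m) value-y ⟩
    + 2 ℤ.* pow2 m ℤ.+ - value (negate y)                ≡⟨ cong (λ p → + 2 ℤ.* p ℤ.+ - value (negate y)) gap ⟨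
    + 2 ℤ.* (value (negate y) ℤ.+ + suc s) ℤ.+ - value (negate y)
                                                         ≡⟨ simplify (value (negate y)) (+ suc s) ⟩
    value (negate y) ℤ.+ + suc s ℤ.+ + suc s             ≡⟨ cong (ℤ._+ + suc s) gap ⟩
    pow2 m ℤ.+ + suc s                                   ∎)
    where
    value-y : value y ≡ - value (negate y)
    value-y = trans (sym (ℤP.neg-involutive (value y))) (cong -_ (sym (value-negate y)))
    simplify : ∀ v s → + 2 ℤ.* (v ℤ.+ s) ℤ.+ - v ≡ v ℤ.+ s ℤ.+ s
    simplify = ℤ-Solver.solve-∀

top-neg-negative : (y : Vec Digit m) → value ((y ∷ʳ zer) ∷ʳ neg) ≢ + n
top-neg-negative {m} {n} y eq with value-gap y
... | s , gap = nonpositive n (begin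
  - + n                                            ≡⟨ cong -_ eq ⟨
  - value ((y ∷ʳ zer) ∷ʳ neg)                      ≡⟨ cong -_ (trans (value-∷ʳ-neg (y ∷ʳ zer))
                                                        (cong₂ ℤ._-_ (value-∷ʳ-zer y) (pow2-suc m))) ⟩
  - (value y ℤ.- + 2 ℤ.* pow2 m)                   ≡⟨ cong (λ p → - (value y ℤ.- + 2 ℤ.* p)) gap ⟨
  - (value y ℤ.- + 2 ℤ.* (value y ℤ.+ + suc s))    ≡⟨ simplify (value y) (+ suc s) ⟩
  value y ℤ.+ + suc s ℤ.+ + suc s                  ≡⟨ cong (ℤ._+ + suc s) gap ⟩
  pow2 m ℤ.+ + suc s                               ≡⟨ cong +_ (+-suc (2 ^ m) s) ⟩
  + suc (2 ^ m + s)                                ∎)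
  where
  open ≡-Reasoning
  simplify : ∀ v s → - (v ℤ.- + 2 ℤ.* (v ℤ.+ s)) ≡ v ℤ.+ s ℤ.+ s
  simplify = ℤ-Solver.solve-∀
  nonpositive : ∀ n {k} → - + n ≢ + suc k
  nonpositive zero    ()
  nonpositive (suc n) ()

reduced-naf-length< : (z : Vec Digit m) → NAF z → T (leadingNonzero z) → value z ≡ + n → m < n + 2
reduced-naf-length< {zero}        []    _   ()   _
reduced-naf-length< {suc zero}    {n} _ _   _    _  = m≤n+m 2 n
reduced-naf-length< {suc (suc j)} {n} z naf lead eq with Vec.initLast z
... | zs , d , refl with Vec.initLast zs
... | y , e , refl = top e d naf (subst T (leadingNonzero-∷ʳ (y ∷ʳ e) d) lead) eq
  where
  top : ∀ e d → NAF ((y ∷ʳ e) ∷ʳ d) → T (nonzero d) → value ((y ∷ʳ e) ∷ʳ d) ≡ + n →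
    suc (suc j) < n + 2
  top e pos naf _ eq with naf-below-top y e pos naf _
  ... | refl = subst (3 + j ≤_) (+-comm 2 n) (+-monoʳ-≤ 2 (top-pos-lower-bound y eq))
  top e neg naf _ eq with naf-below-top y e neg naf _
  ... | refl = ⊥-elim (top-neg-negative y eq)

-- Existence of NAFs

a-sum : ∀ j → a (suc (suc j)) + a (suc j) ≡ 2 ^ suc j + 1
a-sum zero    = refl
a-sum (suc j) = begin
  2 ^ suc j + a (suc j) + a (suc (suc j))   ≡⟨ regroup (2 ^ suc j) (a (suc j)) (a (suc (suc j))) ⟩
  2 ^ suc j + (a (suc (suc j)) + a (suc j)) ≡⟨ cong (_+_ (2 ^ suc j)) (a-sum j) ⟩
  2 ^ suc j + (2 ^ suc j + 1)               ≡⟨ double (2 ^ suc j) ⟩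
  2 ^ suc (suc j) + 1                       ∎
  where
  open ≡-Reasoning
  regroup : ∀ p x y → p + x + y ≡ p + (y + x)
  regroup = ℕ-Solver.solve-∀
  double : ∀ p → p + (p + 1) ≡ 2 * p + 1
  double = ℕ-Solver.solve-∀

a-pos : ∀ j → 1 ≤ a (suc j)
a-pos zero          = s≤s z≤n
a-pos (suc zero)    = s≤s z≤n
a-pos (suc (suc j)) = ≤-trans (a-pos j) (m≤n+m (a (suc j)) (2 ^ suc j))

a≤2^ : ∀ j → a (suc (suc j)) ≤ 2 ^ suc j
a≤2^ j = +-cancelʳ-≤ 1 _ _ (begin
  a (suc (suc j)) + 1            ≤⟨ +-monoʳ-≤ (a (suc (suc j))) (a-pos j) ⟩
  a (suc (suc j)) + a (suc j)    ≡⟨ a-sum j ⟩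
  2 ^ suc j + 1                  ∎)
  where open ≤-Reasoning

a-mono : ∀ j → a (suc j) ≤ a (suc (suc j))
a-mono zero    = s≤s z≤n
a-mono (suc j) = ≤-trans (a≤2^ j) (m≤m+n (2 ^ suc j) (a (suc j)))

shifted-< : ∀ k {n} → 2 ^ suc k ≤ n → n < a (suc (suc (suc k))) → n ∸ 2 ^ suc k < a (suc k)
shifted-< k {n} 2^≤n n<a = +-cancelˡ-< (2 ^ suc k) (n ∸ 2 ^ suc k) (a (suc k))
  (subst (_< a (suc (suc (suc k)))) (sym (m+[n∸m]≡n 2^≤n)) n<a)

mirror-< : ∀ k {n} → a (suc (suc k)) ≤ n → n ≤ 2 ^ suc k → 2 ^ suc k ∸ n < a (suc k)
mirror-< k {n} a≤n n≤2^ = +-cancelʳ-≤ (a (suc (suc k))) (suc (2 ^ suc k ∸ n)) (a (suc k)) (begin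
  suc (2 ^ suc k ∸ n) + a (suc (suc k)) ≤⟨ +-monoʳ-≤ (suc (2 ^ suc k ∸ n)) a≤n ⟩
  suc (2 ^ suc k ∸ n + n)               ≡⟨ cong suc (m∸n+n≡m n≤2^) ⟩
  suc (2 ^ suc k)                       ≡⟨ +-comm 1 (2 ^ suc k) ⟩
  2 ^ suc k + 1                         ≡⟨ trans (+-comm (a (suc k)) _) (a-sum k) ⟨
  a (suc k) + a (suc (suc k))           ∎)
  where open ≤-Reasoning

mutual
  naf-exists : ∀ k n → n < a (suc k) → Σ[ z ∈ Vec Digit k ] NAF z × value z ≡ + n
  naf-exists zero    zero    _         = [] , _ , refl
  naf-exists zero    (suc n) (s≤s ())
  naf-exists (suc k) n       n<a with n <? a (suc k)
  ... | yes n<a′ = let z , naf , vz = naf-exists k n n<a′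
                   in z ∷ʳ zer , naf-∷ʳ-zer z naf , trans (value-∷ʳ-zer z) vz
  ... | no  n≮a′ = let y , naf , vy = reduced-naf-exists k n (≮⇒≥ n≮a′) n<a
                   in y ∷ʳ pos , naf , vy

  reduced-naf-exists : ∀ k n → a (suc k) ≤ n → n < a (suc (suc k)) →
    Σ[ y ∈ Vec Digit k ] NAF (y ∷ʳ pos) × value (y ∷ʳ pos) ≡ + n
  reduced-naf-exists zero    (suc zero)    _   _                 = [] , _ , refl
  reduced-naf-exists zero    (suc (suc n)) _   (s≤s (s≤s ()))
  reduced-naf-exists (suc k) n             a≤n n<a with 2 ^ suc k ≤? n
  ... | yes 2^≤n with naf-exists k (n ∸ 2 ^ suc k) (shifted-< k 2^≤n n<a)
  ...   | s , naf , vs = s ∷ʳ zer , naf-∷ʳ-zer-∷ʳ s pos naf , (begin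
    value ((s ∷ʳ zer) ∷ʳ pos)            ≡⟨ value-∷ʳ-zer-∷ʳ-pos s ⟩
    pow2 (suc k) ℤ.+ value s             ≡⟨ cong (ℤ._+_ (pow2 (suc k))) vs ⟩
    + (2 ^ suc k + (n ∸ 2 ^ suc k))      ≡⟨ cong +_ (m+[n∸m]≡n 2^≤n) ⟩
    + n                                  ∎)
    where open ≡-Reasoning
  reduced-naf-exists (suc k) n a≤n n<a | no 2^≰n
    with naf-exists k (2 ^ suc k ∸ n) (mirror-< k a≤n (<⇒≤ (≰⇒> 2^≰n)))
  ...   | s , naf , vs = negate s ∷ʳ zer , naf-∷ʳ-zer-∷ʳ (negate s) pos (naf-negate s naf) , (begin
    value ((negate s ∷ʳ zer) ∷ʳ pos)          ≡⟨ value-∷ʳ-zer-∷ʳ-pos (negate s) ⟩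
    pow2 (suc k) ℤ.+ value (negate s)         ≡⟨ cong (ℤ._+_ (pow2 (suc k))) (trans (value-negate s) (cong -_ vs)) ⟩
    pow2 (suc k) ℤ.+ - + (2 ^ suc k ∸ n)      ≡⟨ cong (λ x → pow2 (suc k) ℤ.+ - x) (pos-∸ (<⇒≤ (≰⇒> 2^≰n))) ⟩
    pow2 (suc k) ℤ.+ - (pow2 (suc k) ℤ.- + n) ≡⟨ cancel (pow2 (suc k)) (+ n) ⟩
    + n                                       ∎)
    where
    open ≡-Reasoning
    cancel : ∀ p n → p ℤ.+ - (p ℤ.- n) ≡ n
    cancel = ℤ-Solver.solve-∀

-- Evaluating M

reps-below-naf-weight : ∀ m {x w} (y : Vec Digit n) → NAF y → value y ≡ x → w < weight y →
  reps m x w ≡ 0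
reps-below-naf-weight m y naf vy w< = Σ-BSD-zero {m} λ ds → repIndicator-¬ ds λ (v , wt) →
  <⇒≱ w< (subst (weight y ≤_) wt (naf-weight-≤ y ds naf (trans vy (sym v))))

reps-drop-top-pos : ∀ m t w → reps (suc m) (pow2 m ℤ.+ + t) (suc w) ≡ reps m (+ t) w
reps-drop-top-pos m t w = begin
  reps (suc m) x (suc w)
    ≡⟨ reps-∷ʳ m x w ⟩
  reps m (x ℤ.- pow2 m) w + reps m x (suc w) + reps m (x ℤ.+ pow2 m) w
    ≡⟨ cong₂ _+_ (cong₂ _+_ (cong (λ y → reps m y w) (cancel (pow2 m) (+ t))) (reps-above m t (suc w)))
                 (trans (cong (λ y → reps m y w) (shift (pow2 m) (+ t))) (reps-above m (t + 2 ^ m) w)) ⟩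
  reps m (+ t) w + 0 + 0
    ≡⟨ trans (+-identityʳ _) (+-identityʳ _) ⟩
  reps m (+ t) w ∎
  where
  open ≡-Reasoning
  x : ℤ
  x = pow2 m ℤ.+ + t
  cancel : ∀ p t → p ℤ.+ t ℤ.- p ≡ t
  cancel = ℤ-Solver.solve-∀
  shift : ∀ p t → p ℤ.+ t ℤ.+ p ≡ p ℤ.+ (t ℤ.+ p)
  shift = ℤ-Solver.solve-∀

reps-drop-top-zer : ∀ m t w (y : Vec Digit n) → NAF y → value y ≡ + t ℤ.- pow2 m → w ≤ weight y →
  reps (suc m) (+ t) w ≡ reps m (+ t) w
reps-drop-top-zer m t zero    y naf vy _  = reps-∷ʳ-zero m (+ t)
reps-drop-top-zer m t (suc w) y naf vy w< = begin
  reps (suc m) (+ t) (suc w)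
    ≡⟨ reps-∷ʳ m (+ t) w ⟩
  reps m (+ t ℤ.- pow2 m) w + reps m (+ t) (suc w) + reps m (+ t ℤ.+ pow2 m) w
    ≡⟨ cong₂ _+_ (cong (_+ reps m (+ t) (suc w)) (reps-below-naf-weight m y naf vy w<))
                 (trans (cong (λ x → reps m x w) (ℤP.+-comm (+ t) (pow2 m))) (reps-above m t w)) ⟩
  0 + reps m (+ t) (suc w) + 0
    ≡⟨ +-identityʳ _ ⟩
  reps m (+ t) (suc w) ∎
  where open ≡-Reasoning

reps-naf-drop : ∀ {t} (z : Vec Digit m) → NAF z → value z ≡ + t →
  reps (suc (suc m)) (+ t) (weight z) ≡ reps (suc m) (+ t) (weight z)
reps-naf-drop {m} {t} z naf vz =
  reps-drop-top-zer (suc m) t (weight z) ((z ∷ʳ zer) ∷ʳ neg) (naf-∷ʳ-zer-∷ʳ z neg naf)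
  (trans (value-∷ʳ-neg (z ∷ʳ zer)) (cong (ℤ._- pow2 (suc m)) (trans (value-∷ʳ-zer z) vz)))
  (≤-trans (n≤1+n (weight z)) (≤-reflexive (sym (weight-∷ʳ-zer-∷ʳ z neg))))

M-reduced : (z : Vec Digit m) → NAF z → T (leadingNonzero z) → value z ≡ + n →
  M n ≡ reps m (+ n) (weight z)
M-reduced {m} {n} z naf lead eq = begin
  M n                          ≡⟨ sum-applyUpTo-single (n + 2) m id F (reduced-naf-length< z naf lead eq) other ⟩
  F m                          ≡⟨ F≡ m ⟩
  Σ-BSD m (term m)             ≡⟨ Σ-BSD-unique z (λ ds ds≢z → term-zero ds (λ nds lds vds →
                                    ds≢z (naf-unique ds z nds naf (trans vds (sym eq))))) ⟩
  term m z                     ≡⟨ if-true (Equivalence.from (T-∧ {isNAF z})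
                                    (naf , Equivalence.from (T-∧ {leadingNonzero z})
                                             (lead , fromWitness {a? = value z ℤ.≟ + n} eq))) ⟩
  repsOfWeight m n (weight z)  ≡⟨ repsOfWeight≡reps m n (weight z) ⟩
  reps m (+ n) (weight z)      ∎
  where
  open ≡-Reasoning
  isReduced : ∀ {j} → Vec Digit j → Bool
  isReduced ds = isNAF ds ∧ leadingNonzero ds ∧ represents n ds
  F : ℕ → ℕ
  F j = sum (map (λ ds → repsOfWeight j n (weight ds)) (reducedNAFs j n))
  term : ∀ j → Vec Digit j → ℕ
  term j ds = if isReduced ds then repsOfWeight j n (weight ds) else 0
  F≡ : ∀ j → F j ≡ Σ-BSD j (term j)
  F≡ j = trans (sum-map-filterᵇ isReduced _ (allBSD j)) (sum-map-allBSD j (term j))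
  if-true : ∀ {b} {x : ℕ} → T b → (if b then x else 0) ≡ x
  if-true {true} _ = refl
  term-zero : ∀ {j} (ds : Vec Digit j) → (NAF ds → T (leadingNonzero ds) → value ds ≡ + n → ⊥) →
    term j ds ≡ 0
  term-zero ds ¬reduced with isReduced ds in reduced
  ... | false = refl
  ... | true with Equivalence.to (T-∧ {isNAF ds}) (subst T (sym reduced) _)
  ...   | nds , rest with Equivalence.to (T-∧ {leadingNonzero ds}) rest
  ...     | lds , vds = ⊥-elim (¬reduced nds lds (toWitness {a? = value ds ℤ.≟ + n} vds))
  other : ∀ j → j ≢ m → F j ≡ 0
  other j j≢m = trans (F≡ j) (Σ-BSD-zero {j} λ ds → term-zero ds λ nds lds vds →
    j≢m (reduced-naf-length-unique ds z nds naf lds lead (trans vds (sym eq))))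

M-2^+ : ∀ {t} (z : Vec Digit m) → NAF z → value z ≡ + t →
  M (2 ^ suc m + t) ≡ reps (suc m) (+ t) (weight z)
M-2^+ {m} {t} z naf vz = begin
  M (2 ^ suc m + t)
    ≡⟨ M-reduced Z (naf-∷ʳ-zer-∷ʳ z pos naf) (leading-∷ʳ-pos (z ∷ʳ zer)) vZ ⟩
  reps (suc (suc m)) (+ (2 ^ suc m + t)) (weight Z)
    ≡⟨ cong₂ (reps (suc (suc m))) (ℤP.pos-+ (2 ^ suc m) t) (weight-∷ʳ-zer-∷ʳ z pos) ⟩
  reps (suc (suc m)) (pow2 (suc m) ℤ.+ + t) (suc (weight z))
    ≡⟨ reps-drop-top-pos (suc m) t (weight z) ⟩
  reps (suc m) (+ t) (weight z) ∎
  where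
  open ≡-Reasoning
  Z : Vec Digit (2 + m)
  Z = (z ∷ʳ zer) ∷ʳ pos
  vZ : value Z ≡ + (2 ^ suc m + t)
  vZ = trans (value-∷ʳ-zer-∷ʳ-pos z) (trans (cong (ℤ._+_ (pow2 (suc m))) vz) (sym (ℤP.pos-+ (2 ^ suc m) t)))

M-2^+-padded : ∀ {t} (z : Vec Digit m) → NAF z → value z ≡ + t →
  M (2 ^ suc (suc m) + t) ≡ reps (suc m) (+ t) (weight z)
M-2^+-padded {m} z naf vz =
  trans (M-2^+ (z ∷ʳ zer) (naf-∷ʳ-zer z naf) (trans (value-∷ʳ-zer z) vz))
        (trans (cong (reps (suc (suc m)) (+ _)) (weight-∷ʳ z zer)) (reps-naf-drop z naf vz))

M-2^+-reduced : (y : Vec Digit m) → NAF (y ∷ʳ pos) → value (y ∷ʳ pos) ≡ + n →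
  M (2 ^ suc (suc m) + n) ≡ M n
M-2^+-reduced {m} {n} y naf vy = begin
  M (2 ^ suc (suc m) + n)                           ≡⟨ M-2^+ (y ∷ʳ pos) naf vy ⟩
  reps (suc (suc m)) (+ n) (weight (y ∷ʳ pos))      ≡⟨ reps-drop-top-zer (suc m) n _ (y ∷ʳ neg) (naf-∷ʳ-swap y refl naf)
                                                         (trans (value-∷ʳ-neg-via-pos y) (cong (ℤ._- pow2 (suc m)) vy))
                                                         (≤-reflexive (sym (weight-∷ʳ-neg y))) ⟩
  reps (suc m) (+ n) (weight (y ∷ʳ pos))            ≡⟨ M-reduced (y ∷ʳ pos) naf (leading-∷ʳ-pos y) vy ⟨
  M n                                               ∎
  where open ≡-Reasoning

M-mirror : (y : Vec Digit m) → NAF (y ∷ʳ pos) → value (y ∷ʳ pos) ≡ + n →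
  M (2 ^ suc m ∸ n) ≡ reps (suc m) (+ (2 ^ suc m ∸ n)) (weight (y ∷ʳ pos))
M-mirror {m} {n} y naf vy = begin
  M (2 ^ suc m ∸ n)                                         ≡⟨ M-reduced (negate y⁻) naf′ leading′ value′ ⟩
  reps (suc m) (+ (2 ^ suc m ∸ n)) (weight (negate y⁻))    ≡⟨ cong (reps (suc m) (+ (2 ^ suc m ∸ n))) weight′ ⟩
  reps (suc m) (+ (2 ^ suc m ∸ n)) (weight (y ∷ʳ pos))     ∎
  where
  open ≡-Reasoning
  y⁻ : Vec Digit (suc m)
  y⁻ = y ∷ʳ neg
  naf′ : NAF (negate y⁻)
  naf′ = naf-negate y⁻ (naf-∷ʳ-swap y refl naf)
  leading′ : T (leadingNonzero (negate y⁻))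
  leading′ = subst (T ∘ leadingNonzero) (sym (map-∷ʳ negateDigit neg y)) (leading-∷ʳ-pos (negate y))
  value′ : value (negate y⁻) ≡ + (2 ^ suc m ∸ n)
  value′ = begin
    value (negate y⁻)                    ≡⟨ trans (value-negate y⁻) (cong -_ (value-∷ʳ-neg-via-pos y)) ⟩
    - (value (y ∷ʳ pos) ℤ.- pow2 (suc m)) ≡⟨ cong (λ v → - (v ℤ.- pow2 (suc m))) vy ⟩
    - (+ n ℤ.- pow2 (suc m))             ≡⟨ negate-diff (+ n) (pow2 (suc m)) ⟩
    pow2 (suc m) ℤ.- + n                 ≡⟨ pos-∸ (<⇒≤ (value-<-2^ (y ∷ʳ pos) vy)) ⟨
    + (2 ^ suc m ∸ n)                    ∎
    where
    negate-diff : ∀ n p → - (n ℤ.- p) ≡ p ℤ.- n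
    negate-diff = ℤ-Solver.solve-∀
  weight′ : weight (negate y⁻) ≡ weight (y ∷ʳ pos)
  weight′ = trans (weight-negate y⁻) (weight-∷ʳ-neg y)

M-2^+-split : (y : Vec Digit m) → NAF (y ∷ʳ pos) → value (y ∷ʳ pos) ≡ + n →
  M (2 ^ suc m + n) ≡ M (2 ^ suc m ∸ n) + M n
M-2^+-split {m} {n} y naf vy = begin
  M (H + n)
    ≡⟨ M-reduced Z (naf-∷ʳ-zer-∷ʳ (y ∷ʳ neg) pos naf⁻) (leading-∷ʳ-pos ((y ∷ʳ neg) ∷ʳ zer)) vZ ⟩
  reps (3 + m) X (weight Z)
    ≡⟨ cong (reps (3 + m) X) (trans (weight-∷ʳ-zer-∷ʳ (y ∷ʳ neg) pos) (cong suc (weight-∷ʳ-neg y))) ⟩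
  reps (3 + m) X (suc w)
    ≡⟨ reps-∷ʳ (2 + m) X w ⟩
  reps (2 + m) (X ℤ.- P) w + reps (2 + m) X (suc w) + reps (2 + m) (X ℤ.+ P) w
    ≡⟨ cong₂ _+_ (cong₂ _+_ lower middle) upper ⟩
  M (H ∸ n) + M n + 0
    ≡⟨ +-identityʳ _ ⟩
  M (H ∸ n) + M n ∎
  where
  open ≡-Reasoning
  H : ℕ
  H = 2 ^ suc m
  X : ℤ
  X = + (H + n)
  P : ℤ
  P = pow2 (suc (suc m))
  w : ℕ
  w = weight (y ∷ʳ pos)
  naf⁻ : NAF (y ∷ʳ neg)
  naf⁻ = naf-∷ʳ-swap y refl naf
  Z : Vec Digit (3 + m)
  Z = ((y ∷ʳ neg) ∷ʳ zer) ∷ʳ pos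
  vZ : value Z ≡ X
  vZ = begin
    value Z                                          ≡⟨ value-∷ʳ-zer-∷ʳ-pos (y ∷ʳ neg) ⟩
    P ℤ.+ value (y ∷ʳ neg)                           ≡⟨ cong₂ ℤ._+_ (pow2-suc (suc m))
                                                          (trans (value-∷ʳ-neg-via-pos y) (cong (ℤ._- pow2 (suc m)) vy)) ⟩
    + 2 ℤ.* pow2 (suc m) ℤ.+ (+ n ℤ.- pow2 (suc m))  ≡⟨ collapse (pow2 (suc m)) (+ n) ⟩
    pow2 (suc m) ℤ.+ + n                             ≡⟨ ℤP.pos-+ H n ⟨
    X                                                ∎
    where
    collapse : ∀ p n → + 2 ℤ.* p ℤ.+ (n ℤ.- p) ≡ p ℤ.+ n
    collapse = ℤ-Solver.solve-∀
  H∸n≡ : + (H ∸ n) ≡ pow2 (suc m) ℤ.- + n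
  H∸n≡ = pos-∸ (<⇒≤ (value-<-2^ (y ∷ʳ pos) vy))
  lower : reps (2 + m) (X ℤ.- P) w ≡ M (H ∸ n)
  lower = begin
    reps (2 + m) (X ℤ.- P) w       ≡⟨ cong (λ x → reps (2 + m) x w) (begin
      X ℤ.- P                                        ≡⟨ cong₂ ℤ._-_ (ℤP.pos-+ H n) (pow2-suc (suc m)) ⟩
      pow2 (suc m) ℤ.+ + n ℤ.- + 2 ℤ.* pow2 (suc m)  ≡⟨ flip (pow2 (suc m)) (+ n) ⟩
      - (pow2 (suc m) ℤ.- + n)                       ≡⟨ cong -_ H∸n≡ ⟨
      - + (H ∸ n)                                    ∎) ⟩
    reps (2 + m) (- + (H ∸ n)) w   ≡⟨ reps-negate (2 + m) (+ (H ∸ n)) w ⟩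
    reps (2 + m) (+ (H ∸ n)) w     ≡⟨ reps-drop-top-zer (suc m) (H ∸ n) w (negate (y ∷ʳ pos))
                                        (naf-negate (y ∷ʳ pos) naf) mirrored-value
                                        (≤-reflexive (sym (weight-negate (y ∷ʳ pos)))) ⟩
    reps (suc m) (+ (H ∸ n)) w     ≡⟨ M-mirror y naf vy ⟨
    M (H ∸ n)                      ∎
    where
    flip : ∀ p n → p ℤ.+ n ℤ.- + 2 ℤ.* p ≡ - (p ℤ.- n)
    flip = ℤ-Solver.solve-∀
    unshift : ∀ p n → - n ≡ p ℤ.- n ℤ.- p
    unshift = ℤ-Solver.solve-∀
    mirrored-value : value (negate (y ∷ʳ pos)) ≡ + (H ∸ n) ℤ.- pow2 (suc m)
    mirrored-value = trans (value-negate (y ∷ʳ pos)) (trans (cong -_ vy)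
      (trans (unshift (pow2 (suc m)) (+ n)) (cong (ℤ._- pow2 (suc m)) (sym H∸n≡))))
  middle : reps (2 + m) X (suc w) ≡ M n
  middle = begin
    reps (2 + m) X (suc w)                        ≡⟨ cong (λ x → reps (2 + m) x (suc w)) (ℤP.pos-+ H n) ⟩
    reps (2 + m) (pow2 (suc m) ℤ.+ + n) (suc w)   ≡⟨ reps-drop-top-pos (suc m) n w ⟩
    reps (suc m) (+ n) w                          ≡⟨ M-reduced (y ∷ʳ pos) naf (leading-∷ʳ-pos y) vy ⟨
    M n                                           ∎
  upper : reps (2 + m) (X ℤ.+ P) w ≡ 0
  upper = trans (cong (λ x → reps (2 + m) x w) (ℤP.+-comm X P)) (reps-above (2 + m) (H + n) w)

M-2^-∸ : ∀ {t} (z : Vec Digit m) → NAF z → value z ≡ + t →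
  M (2 ^ suc (suc m) ∸ t) ≡ reps (suc m) (+ t) (weight z)
M-2^-∸ {m} {t} z naf vz = begin
  M (Q ∸ t)
    ≡⟨ M-reduced Z (naf-∷ʳ-zer-∷ʳ z′ pos naf′) (leading-∷ʳ-pos (z′ ∷ʳ zer)) vZ ⟩
  reps (3 + m) X (weight Z)
    ≡⟨ cong (reps (3 + m) X) (trans (weight-∷ʳ-zer-∷ʳ z′ pos) (cong suc w′)) ⟩
  reps (3 + m) X (suc w)
    ≡⟨ reps-∷ʳ (2 + m) X w ⟩
  reps (2 + m) (X ℤ.- P) w + reps (2 + m) X (suc w) + reps (2 + m) (X ℤ.+ P) w
    ≡⟨ cong₂ _+_ (cong₂ _+_ lower middle) upper ⟩
  reps (suc m) (+ t) w + 0 + 0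
    ≡⟨ trans (+-identityʳ _) (+-identityʳ _) ⟩
  reps (suc m) (+ t) w ∎
  where
  open ≡-Reasoning
  Q : ℕ
  Q = 2 ^ suc (suc m)
  H : ℕ
  H = 2 ^ suc m
  P : ℤ
  P = pow2 (suc (suc m))
  X : ℤ
  X = + (Q ∸ t)
  w : ℕ
  w = weight z
  t≤H : t ≤ H
  t≤H = ≤-trans (<⇒≤ (value-<-2^ z vz)) (m≤m+n (2 ^ m) (2 ^ m + 0))
  X≡ : X ≡ P ℤ.- + t
  X≡ = pos-∸ (≤-trans t≤H (m≤m+n H (H + 0)))
  z′ : Vec Digit (suc m)
  z′ = negate z ∷ʳ zer
  naf′ : NAF z′
  naf′ = naf-∷ʳ-zer (negate z) (naf-negate z naf)
  w′ : weight z′ ≡ w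
  w′ = trans (weight-∷ʳ (negate z) zer) (weight-negate z)
  v′ : value z′ ≡ - + t
  v′ = trans (value-∷ʳ-zer (negate z)) (trans (value-negate z) (cong -_ vz))
  Z : Vec Digit (3 + m)
  Z = (z′ ∷ʳ zer) ∷ʳ pos
  vZ : value Z ≡ X
  vZ = trans (value-∷ʳ-zer-∷ʳ-pos z′) (trans (cong (ℤ._+_ P) v′) (sym X≡))
  lower : reps (2 + m) (X ℤ.- P) w ≡ reps (suc m) (+ t) w
  lower = begin
    reps (2 + m) (X ℤ.- P) w    ≡⟨ cong (λ x → reps (2 + m) x w) (trans (cong (ℤ._- P) X≡) (cancel P (+ t))) ⟩
    reps (2 + m) (- + t) w      ≡⟨ reps-negate (2 + m) (+ t) w ⟩
    reps (2 + m) (+ t) w        ≡⟨ reps-naf-drop z naf vz ⟩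
    reps (suc m) (+ t) w        ∎
    where
    cancel : ∀ p t → p ℤ.- t ℤ.- p ≡ - t
    cancel = ℤ-Solver.solve-∀
  X≡′ : X ≡ pow2 (suc m) ℤ.+ + (H ∸ t)
  X≡′ = begin
    X                                         ≡⟨ X≡ ⟩
    P ℤ.- + t                                 ≡⟨ cong (ℤ._- + t) (pow2-suc (suc m)) ⟩
    + 2 ℤ.* pow2 (suc m) ℤ.- + t              ≡⟨ split (pow2 (suc m)) (+ t) ⟩
    pow2 (suc m) ℤ.+ (pow2 (suc m) ℤ.- + t)   ≡⟨ cong (ℤ._+_ (pow2 (suc m))) (pos-∸ t≤H) ⟨
    pow2 (suc m) ℤ.+ + (H ∸ t)                ∎
    where
    split : ∀ p t → + 2 ℤ.* p ℤ.- t ≡ p ℤ.+ (p ℤ.- t)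
    split = ℤ-Solver.solve-∀
  v⁺ : value (z′ ∷ʳ pos) ≡ X ℤ.- pow2 (suc m)
  v⁺ = begin
    value (z′ ∷ʳ pos)                         ≡⟨ trans (value-∷ʳ-pos z′) (cong (ℤ._+ pow2 (suc m)) v′) ⟩
    - + t ℤ.+ pow2 (suc m)                    ≡⟨ rotate (pow2 (suc m)) (+ t) ⟩
    pow2 (suc m) ℤ.+ (pow2 (suc m) ℤ.- + t) ℤ.- pow2 (suc m)
                                              ≡⟨ cong (λ h → pow2 (suc m) ℤ.+ h ℤ.- pow2 (suc m)) (pos-∸ t≤H) ⟨
    pow2 (suc m) ℤ.+ + (H ∸ t) ℤ.- pow2 (suc m) ≡⟨ cong (ℤ._- pow2 (suc m)) X≡′ ⟨
    X ℤ.- pow2 (suc m)                        ∎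
    where
    rotate : ∀ p t → - t ℤ.+ p ≡ p ℤ.+ (p ℤ.- t) ℤ.- p
    rotate = ℤ-Solver.solve-∀
  middle : reps (2 + m) X (suc w) ≡ 0
  middle = begin
    reps (2 + m) X (suc w)                              ≡⟨ reps-drop-top-zer (suc m) (Q ∸ t) (suc w) (z′ ∷ʳ pos)
                                                            (naf-∷ʳ-zer-∷ʳ (negate z) pos (naf-negate z naf)) v⁺
                                                            (≤-reflexive (sym (trans (weight-∷ʳ z′ pos) (cong suc w′)))) ⟩
    reps (suc m) X (suc w)                              ≡⟨ cong (λ x → reps (suc m) x (suc w)) X≡′ ⟩
    reps (suc m) (pow2 (suc m) ℤ.+ + (H ∸ t)) (suc w)   ≡⟨ reps-above (suc m) (H ∸ t) (suc w) ⟩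
    0                                                   ∎
  upper : reps (2 + m) (X ℤ.+ P) w ≡ 0
  upper = trans (cong (λ x → reps (2 + m) x w) (ℤP.+-comm X P)) (reps-above (2 + m) (Q ∸ t) w)

-- The subintervals of I_k

b≡ : ∀ j → b (3 + j) ≡ 2 ^ suc j + a (suc (suc j))
b≡ j = trans (+-assoc (2 ^ suc j) (a (suc j)) _) (cong (_+_ (2 ^ suc j)) (m+[n∸m]≡n (a-mono j)))

c≡ : ∀ j → c (3 + j) ≡ 2 ^ suc (suc j) + a (suc j)
c≡ j = begin
  b (3 + j) + (a (3 + j) ∸ a (2 + j))         ≡⟨ cong (_+ (a (3 + j) ∸ a (2 + j))) (b≡ j) ⟩
  2 ^ suc j + a (2 + j) + (a (3 + j) ∸ a (2 + j)) ≡⟨ +-assoc (2 ^ suc j) (a (2 + j)) _ ⟩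
  2 ^ suc j + (a (2 + j) + (a (3 + j) ∸ a (2 + j))) ≡⟨ cong (_+_ (2 ^ suc j)) (m+[n∸m]≡n (a-mono (suc j))) ⟩
  2 ^ suc j + (2 ^ suc j + a (suc j))         ≡⟨ +-assoc (2 ^ suc j) (2 ^ suc j) (a (suc j)) ⟨
  2 ^ suc j + 2 ^ suc j + a (suc j)           ≡⟨ cong (_+ a (suc j)) (2^-suc (suc j)) ⟨
  2 ^ suc (suc j) + a (suc j)                 ∎
  where open ≡-Reasoning

𝒜-offset : ∀ j {v} → v < sizeI (suc j) → a (suc j) + v < a (suc (suc j))
𝒜-offset j {v} v< = subst (a (suc j) + v <_) (m+[n∸m]≡n (a-mono j)) (+-monoʳ-< (a (suc j)) v<)

ℬ-offset : ∀ j {u} → u ≤ 2 ^ suc (suc j) ∸ b (3 + j) → a (suc (suc j)) + u ≤ 2 ^ suc j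
ℬ-offset j {u} u≤ = +-cancelˡ-≤ (2 ^ suc j) _ _ (begin
  2 ^ suc j + (a (2 + j) + u)  ≡⟨ rotate (2 ^ suc j) (a (2 + j)) u ⟩
  u + (2 ^ suc j + a (2 + j))  ≡⟨ cong (_+_ u) (b≡ j) ⟨
  u + b (3 + j)                ≤⟨ m≤o∸n⇒m+n≤o u b≤ u≤ ⟩
  2 ^ suc (suc j)              ≡⟨ 2^-suc (suc j) ⟩
  2 ^ suc j + 2 ^ suc j        ∎)
  where
  open ≤-Reasoning
  rotate : ∀ p x u → p + (x + u) ≡ u + (p + x)
  rotate = ℕ-Solver.solve-∀
  b≤ : b (3 + j) ≤ 2 ^ suc (suc j)
  b≤ = subst₂ _≤_ (sym (b≡ j)) (sym (2^-suc (suc j))) (+-monoʳ-≤ (2 ^ suc j) (a≤2^ j))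

M-on-𝒜 : ∀ j v → v < sizeI (suc j) →
  M (a (3 + j) + v) ≡ M (2 ^ suc j ∸ (a (suc j) + v)) + M (a (suc j) + v)
M-on-𝒜 j v v< with reduced-naf-exists j (a (suc j) + v) (m≤m+n (a (suc j)) v) (𝒜-offset j v<)
... | y , naf , vy = trans (cong M (+-assoc (2 ^ suc j) (a (suc j)) v)) (M-2^+-split y naf vy)

M-on-𝒞 : ∀ j v → v < sizeI (suc j) → M (c (3 + j) + v) ≡ M (a (suc j) + v)
M-on-𝒞 j v v< with reduced-naf-exists j (a (suc j) + v) (m≤m+n (a (suc j)) v) (𝒜-offset j v<)
... | y , naf , vy = trans (cong M (trans (cong (_+ v) (c≡ j)) (+-assoc (2 ^ suc (suc j)) (a (suc j)) v)))
                           (M-2^+-reduced y naf vy)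

module _ (j u : ℕ) (u≤ : u ≤ 2 ^ suc (suc j) ∸ b (3 + j)) where
  private
    H : ℕ
    H = 2 ^ suc j
    r : ℕ
    r = a (suc (suc j)) + u
    t : ℕ
    t = H ∸ r
    r≤H : r ≤ H
    r≤H = ℬ-offset j u≤
    b+u≡ : b (3 + j) + u ≡ H + r
    b+u≡ = trans (cong (_+ u) (b≡ j)) (+-assoc H (a (suc (suc j))) u)
    NAF-t : Σ[ z ∈ Vec Digit j ] NAF z × value z ≡ + t
    NAF-t = naf-exists j t (mirror-< j (m≤m+n (a (suc (suc j))) u) r≤H)
    z : Vec Digit j
    z = proj₁ NAF-t
    naf : NAF z
    naf = proj₁ (proj₂ NAF-t)
    vz : value z ≡ + t
    vz = proj₂ (proj₂ NAF-t)
    reference : M (2 ^ suc (suc j) ∸ r) ≡ reps (suc j) (+ t) (weight z)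
    reference = trans (cong M (trans (cong (_∸ r) (2^-suc (suc j))) (+-∸-assoc H r≤H))) (M-2^+ z naf vz)

  M-on-ℬ : M (b (3 + j) + u) ≡ M (2 ^ suc (suc j) ∸ (a (suc (suc j)) + u))
  M-on-ℬ = begin
    M (b (3 + j) + u)          ≡⟨ cong M (trans b+u≡ as-mirror) ⟩
    M (2 ^ suc (suc j) ∸ t)    ≡⟨ M-2^-∸ z naf vz ⟩
    reps (suc j) (+ t) (weight z) ≡⟨ reference ⟨
    M (2 ^ suc (suc j) ∸ r)    ∎
    where
    open ≡-Reasoning
    as-mirror : H + r ≡ 2 ^ suc (suc j) ∸ t
    as-mirror = sym (begin
      2 ^ suc (suc j) ∸ t      ≡⟨ cong (_∸ t) (2^-suc (suc j)) ⟩
      (H + H) ∸ t              ≡⟨ +-∸-assoc H (m∸n≤m H r) ⟩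
      H + (H ∸ t)              ≡⟨ cong (_+_ H) (m∸[m∸n]≡n r≤H) ⟩
      H + r                    ∎)

  M-on-ℬ-mirror : M (2 ^ (3 + j) ∸ (b (3 + j) + u)) ≡ M (2 ^ suc (suc j) ∸ (a (suc (suc j)) + u))
  M-on-ℬ-mirror = begin
    M (2 ^ (3 + j) ∸ (b (3 + j) + u))   ≡⟨ cong M (trans (cong (2 ^ (3 + j) ∸_) b+u≡) as-padded) ⟩
    M (2 ^ suc (suc j) + t)             ≡⟨ M-2^+-padded z naf vz ⟩
    reps (suc j) (+ t) (weight z)       ≡⟨ reference ⟨
    M (2 ^ suc (suc j) ∸ r)             ∎
    where
    open ≡-Reasoning
    Q : ℕ
    Q = 2 ^ suc (suc j)
    as-padded : 2 ^ (3 + j) ∸ (H + r) ≡ Q + t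
    as-padded = begin
      2 ^ (3 + j) ∸ (H + r)    ≡⟨ cong (_∸ (H + r)) (2^-suc (suc (suc j))) ⟩
      (Q + Q) ∸ (H + r)        ≡⟨ +-∸-assoc Q (subst (H + r ≤_) (sym (2^-suc (suc j))) (+-monoʳ-≤ H r≤H)) ⟩
      Q + (Q ∸ (H + r))        ≡⟨ cong (λ q → Q + (q ∸ (H + r))) (2^-suc (suc j)) ⟩
      Q + ((H + H) ∸ (H + r))  ≡⟨ cong (_+_ Q) ([m+n]∸[m+o]≡n∸o H H r) ⟩
      Q + t                    ∎

mainTheorem5 : (k v u : ℕ) → 3 ≤ k → v < sizeI (k ∸ 2) → u ≤ 2 ^ (k ∸ 1) ∸ b k →
    (M (a k + v) ≡ M (2 ^ (k ∸ 2) ∸ (a (k ∸ 2) + v)) + M (a (k ∸ 2) + v))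
    × (M (b k + u) ≡ M (2 ^ (k ∸ 1) ∸ (a (k ∸ 1) + u)))
    × (M (2 ^ k ∸ (b k + u)) ≡ M (2 ^ (k ∸ 1) ∸ (a (k ∸ 1) + u)))
    × (M (c k + v) ≡ M (a (k ∸ 2) + v))
mainTheorem5 (suc (suc (suc j))) v u _         v< u≤ =
  M-on-𝒜 j v v< , M-on-ℬ j u u≤ , M-on-ℬ-mirror j u u≤ , M-on-𝒞 j v v<
mainTheorem5 (suc (suc zero))    v u (s≤s (s≤s ())) _ _
mainTheorem5 (suc zero)          v u (s≤s ())       _ _
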